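{- For $n\geqslant 2$, $$\sum_{\pi\in\mathcal{S}_n}x^{\mathrm{exc}(\pi)}2^{n-\mathrm{cyc}(\pi)}=\sum_{i=0}^{\lfloor (n-1)/2\rfloor}\xi^+_{n,i}x^i(1+x)^{n-1-2i}+x\sum_{j=0}^{\lfloor (n-2)/2\rfloor}\xi^-_{n,j}x^j(1+x)^{n-2-2j},$$ where, letting $\mathcal{S}_{n,m}$ denote the set of permutations in $\mathcal{S}_n$ with exactly $m$ cycle runs, $$\xi^+_{n,i}=\sum_{\pi\in\mathcal{S}_{n,2i+1}}2^{\mathrm{crun}(\pi)-\mathrm{cyc}(\pi)}=\sum_{\pi\in\mathcal{S}_{n,2i+1}}4^{\mathrm{cpk}(\pi)},\qquad \xi^-_{n,j}=\sum_{\pi\in\mathcal{S}_{n,2j+2}}2^{\mathrm{crun}(\pi)-\mathrm{cyc}(\pi)}=\sum_{\pi\in\mathcal{S}_{n,2j+2}}4^{\mathrm{cpk}(\pi)}.$$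
   Context: For $\pi\in\mathcal{S}_n$, $\mathrm{exc}(\pi)=\#\{i:\pi(i)>i\}$ and $\mathrm{cyc}(\pi)$ is the number of cycles. Write each cycle $w$ of $\pi$ in canonical form $w=y_1y_2\cdots y_j$ where $y_1$ is the smallest element of the cycle and $y_i=\pi^{i-1}(y_1)$; set $y_{j+1}=+\infty$. A cycle peak of $w$ is an entry $y_i$ with $2\leqslant i\leqslant j$ and $y_{i-1}<y_i>y_{i+1}$; $\mathrm{cpk}(w)$ is their number. The number of cycle runs $\mathrm{crun}(w)$ is the number of alternating runs (maximal consecutive increasing or decreasing subsequences) of the word $y_1y_2\cdots y_j(+\infty)$. For $\pi$ with cycles $w_1,\dots,w_s$, $\mathrm{crun}(\pi)=\sum_i\mathrm{crun}(w_i)$ and $\mathrm{cpk}(\pi)=\sum_i\mathrm{cpk}(w_i)$. -}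

module Defs where

open import Data.Nat using (ℕ; zero; suc; _+_; _*_; _∸_; _^_; _<ᵇ_; _≡ᵇ_; _/_)
open import Data.Bool using (Bool; true; false; if_then_else_; _∧_; _∨_; not)
open import Data.Fin using (Fin; toℕ)
open import Data.Fin.Properties using (_≟_)
open import Data.Nat.ListAction using (sum)
open import Data.List using (List; []; _∷_; map; filter; length; concatMap; allFin; upTo; _++_; [_])
open import Data.Vec using (Vec; lookup) renaming ([] to []ᵥ; _∷_ to _∷ᵥ_)
open import Relation.Nullary.Decidable using (⌊_⌋)

-- A permutation of [n] = {0,…,n-1} (i.e. Fin n) is given in one-line
-- notation as a vector v with π(i) = lookup v i.

allVecs : (n k : ℕ) → List (Vec (Fin n) k)
allVecs n zero    = [ []ᵥ ]
allVecs n (suc k) = concatMap (λ a → map (a ∷ᵥ_) (allVecs n k)) (allFin n)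

allᶠ : (n : ℕ) → (Fin n → Bool) → Bool
allᶠ n p = Data.List.foldr (λ i b → p i ∧ b) true (allFin n)

injective? : {n : ℕ} → Vec (Fin n) n → Bool
injective? {n} v =
  allᶠ n (λ i → allᶠ n (λ j → not ⌊ lookup v i ≟ lookup v j ⌋ ∨ ⌊ i ≟ j ⌋))

Perm : ℕ → Set
Perm n = Vec (Fin n) n

S : (n : ℕ) → List (Perm n)
S n = filter (λ v → Data.Bool._≟_ (injective? v) true) (allVecs n n)

count : {A : Set} → (A → Bool) → List A → ℕ
count p xs = length (filter (λ a → Data.Bool._≟_ (p a) true) xs)

iter : {n : ℕ} → Perm n → ℕ → Fin n → Fin n
iter π zero    i = i
iter π (suc k) i = lookup π (iter π k i)

exc : {n : ℕ} → Perm n → ℕ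
exc {n} π = count (λ i → toℕ i <ᵇ toℕ (lookup π i)) (allFin n)

isCycleMin : {n : ℕ} → Perm n → Fin n → Bool
isCycleMin {n} π y =
  Data.List.foldr (λ k b → not (toℕ (iter π (suc k) y) <ᵇ toℕ y) ∧ b) true (upTo n)

cycleMins : {n : ℕ} → Perm n → List (Fin n)
cycleMins {n} π = filter (λ y → Data.Bool._≟_ (isCycleMin π y) true) (allFin n)

cyc : {n : ℕ} → Perm n → ℕ
cyc π = length (cycleMins π)

-- canonical form y₁ y₂ ⋯ y_j of the cycle with minimum y, y_i = π^{i-1}(y):
-- follow π from y until returning to y (fuel n suffices)
cycleWord : {n : ℕ} → Perm n → Fin n → List ℕ
cycleWord {n} π y = toℕ y ∷ go n (lookup π y)
  where
  go : ℕ → Fin n → List ℕ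
  go zero    z = []
  go (suc f) z = if ⌊ z ≟ y ⌋ then [] else toℕ z ∷ go f (lookup π z)

data ℕ∞ : Set where
  fin : ℕ → ℕ∞
  ∞   : ℕ∞

_<∞_ : ℕ∞ → ℕ∞ → Bool
fin a <∞ fin b = a <ᵇ b
fin a <∞ ∞     = true
∞     <∞ _     = false

extWord : List ℕ → List ℕ∞
extWord w = map fin w ++ [ ∞ ]

altRunsFrom : Bool → ℕ∞ → List ℕ∞ → ℕ
altRunsFrom d a []       = 0
altRunsFrom d a (b ∷ bs) =
  (if ⌊ Data.Bool._≟_ (a <∞ b) d ⌋ then 0 else 1) + altRunsFrom (a <∞ b) b bs

altRuns : List ℕ∞ → ℕ
altRuns []           = 0
altRuns (a ∷ [])     = 0
altRuns (a ∷ b ∷ bs) = 1 + altRunsFrom (a <∞ b) b bs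

-- cycle peaks: y_i with 2 ≤ i ≤ j and y_{i-1} < y_i > y_{i+1}, y_{j+1} = +∞
peaksFrom : ℕ∞ → ℕ∞ → List ℕ∞ → ℕ
peaksFrom a b []       = 0
peaksFrom a b (c ∷ cs) =
  (if (a <∞ b) ∧ (c <∞ b) then 1 else 0) + peaksFrom b c cs

cpkWord : List ℕ → ℕ
cpkWord w with extWord w
... | a ∷ b ∷ cs = peaksFrom a b cs
... | _          = 0

crunWord : List ℕ → ℕ
crunWord w = altRuns (extWord w)

crun : {n : ℕ} → Perm n → ℕ
crun π = sum (map (λ y → crunWord (cycleWord π y)) (cycleMins π))

cpk : {n : ℕ} → Perm n → ℕ
cpk π = sum (map (λ y → cpkWord (cycleWord π y)) (cycleMins π))

Snm : (n m : ℕ) → List (Perm n)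
Snm n m = filter (λ π → Data.Nat._≟_ (crun π) m) (S n)

ξ⁺ : ℕ → ℕ → ℕ
ξ⁺ n i = sum (map (λ π → 2 ^ (crun π ∸ cyc π)) (Snm n (2 * i + 1)))

ξ⁻ : ℕ → ℕ → ℕ
ξ⁻ n j = sum (map (λ π → 2 ^ (crun π ∸ cyc π)) (Snm n (2 * j + 2)))

ξ⁺' : ℕ → ℕ → ℕ
ξ⁺' n i = sum (map (λ π → 4 ^ cpk π) (Snm n (2 * i + 1)))

ξ⁻' : ℕ → ℕ → ℕ
ξ⁻' n j = sum (map (λ π → 4 ^ cpk π) (Snm n (2 * j + 2)))

lhs : ℕ → ℕ → ℕ
lhs n x = sum (map (λ π → x ^ exc π * 2 ^ (n ∸ cyc π)) (S n))

rhs : ℕ → ℕ → ℕ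
rhs n x =
  sum (map (λ i → ξ⁺ n i * x ^ i * (1 + x) ^ (n ∸ 1 ∸ 2 * i))
           (upTo (suc ((n ∸ 1) / 2))))
  + x * sum (map (λ j → ξ⁻ n j * x ^ j * (1 + x) ^ (n ∸ 2 ∸ 2 * j))
                 (upTo (suc ((n ∸ 2) / 2))))

-- Inserting the maximum n + 1 into a permutation of [n], either as a new fixed point or right
-- after some a in its cycle, produces every permutation of [n + 1] exactly once. Following exc, cyc
-- and a pointwise description of cycle peaks through the insertion gives the recurrences
--   u(n+1, e) = (2e + 1) u(n, e) + 2 (n - e + 1) u(n, e - 1)      for u(n, e) = Σ_{exc π = e} 2^(n - cyc π),
--   t(n+1, m) = t(n, m - 1) + m t(n, m) + 4 (n - m + 2) t(n, m - 2)  for t(n, m) = Σ_{crun π = m} 2^(crun π - cyc π).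
-- Coefficientwise, the first recurrence maps x^⌊m/2⌋ (1 + x)^(n - m) to exactly the combination that
-- the second recurrence prescribes, so Σ_e u(n, e) x^e = Σ_m t(n, m) x^⌊m/2⌋ (1 + x)^(n - m) by
-- induction on n; splitting m by parity gives the right-hand side. A cycle word starts at its minimum
-- and ends with +∞, so its runs are one plus two per peak: crun = cyc + 2 cpk, whence 2^(crun - cyc) = 4^cpk.

module Submission where

open import Defs

open import Data.Bool using (Bool; true; false; not; _∧_; _∨_; if_then_else_; T)
import Data.Bool.Properties as Bool
open import Data.Empty using (⊥; ⊥-elim)
open import Data.Fin using (Fin; zero; suc; toℕ; fromℕ; inject₁)
open import Data.Fin.Permutation using (permutation)
open import Data.Fin.Properties using (toℕ<n; toℕ-inject₁; toℕ-fromℕ; toℕ-injective; inject₁-injective; fromℕ≢inject₁; pigeonhole; any?)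
  renaming (_≟_ to _≟ᶠ_; suc-injective to suc-injectiveᶠ)
open import Data.Fin.Relation.Unary.Top using (view; ‵fromℕ; ‵inject₁; view-fromℕ; view-inject₁)
open import Data.List using (List; []; _∷_; _++_; map; filter; allFin; tabulate; applyUpTo; upTo; concatMap; foldr; cartesianProductWith)
open import Data.List.Extrema.Nat using (argmin; f[argmin]≤f[xs])
open import Data.List.Membership.Propositional using (_∈_)
open import Data.List.Membership.Propositional.Properties
  using (∈-upTo⁺; ∈-applyUpTo⁺; ∈-applyUpTo⁻; ∈-filter⁺; ∈-filter⁻; ∈-allFin; ∈-cartesianProductWith⁺; ∈-cartesianProductWith⁻)
open import Data.List.Membership.Propositional.Properties.WithK using (unique∧set⇒bag)
open import Data.List.Properties using (map-tabulate; map-++; foldr-cong)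
open import Data.List.Relation.Binary.BagAndSetEquality using (∼bag⇒↭)
import Data.List.Relation.Binary.Permutation.Propositional.Properties as ↭
import Data.List.Relation.Unary.All as All
import Data.List.Relation.Unary.AllPairs as AllPairs
open import Data.List.Relation.Unary.Any using (here; there)
open import Data.List.Relation.Unary.Linked using (Linked; []; [-]; _∷_)
open import Data.List.Relation.Unary.Unique.Propositional using (Unique)
open import Data.List.Relation.Unary.Unique.Propositional.Properties using (applyUpTo⁺₁; filter⁺; allFin⁺; cartesianProductWith⁺)
open import Data.Nat using (ℕ; zero; suc; _+_; _*_; _∸_; _^_; _≤_; _<_; z≤n; s≤s; _≡ᵇ_; _<ᵇ_; _≟_; _≤?_; _<?_; _/_; ⌊_/2⌋; compare; less; equal; greater)
open import Data.Nat.DivMod using (m≡m%n+[m/n]*n; m%n<n; m/n≤m)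
open import Data.Nat.ListAction using (sum)
open import Data.Nat.ListAction.Properties using (sum-↭; sum-++)
open import Data.Nat.Properties
open import Data.Nat.Solver using (module +-*-Solver)
open import Data.Product using (Σ; _×_; _,_; proj₁; proj₂)
open import Data.Sum using (_⊎_; inj₁; inj₂)
open import Data.Vec using (Vec; lookup) renaming ([] to []ᵥ; _∷_ to _∷ᵥ_; tabulate to tabulateᵥ)
open import Data.Vec.Properties using (lookup∘tabulate; tabulate∘lookup; tabulate-cong; ∷-injective)
open import Function.Base using (case_of_)
open import Function.Bundles using (mk⇔)
open import Function.Definitions using (Injective)
open import Relation.Binary.Definitions using (tri<; tri≈; tri>)
open import Relation.Binary.PropositionalEquality
open import Relation.Nullary using (¬_; Dec; yes; no; does; contradiction; _×-dec_)
open import Relation.Nullary.Decidable using (⌊_⌋; dec-true; dec-false; does-⇔)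
open import Algebra.Properties.Semiring.Sum +-*-semiring
  using (sum-syntax; ∑-distrib-+; ∑-comm; ∑-permute; *-distribˡ-sum; *-distribʳ-sum; sum-cong-≗; sum-init-last; sum-replicate-zero)

open +-*-Solver
open ≡-Reasoning

infixr 5 _∙_
_∙_ : ∀ {A : Set} {x y z : A} → x ≡ y → y ≡ z → x ≡ z
_∙_ = trans

𝟙 : Bool → ℕ
𝟙 true = 1
𝟙 false = 0

𝟙≤1 : ∀ b → 𝟙 b ≤ 1
𝟙≤1 true = s≤s z≤n
𝟙≤1 false = z≤n

𝟙-+-𝟙-not : ∀ b → 𝟙 b + 𝟙 (not b) ≡ 1
𝟙-+-𝟙-not true = refl
𝟙-+-𝟙-not false = refl

∑-*ˡ : ∀ {n} c (f : Fin n → ℕ) → ∑[ i < n ] (c * f i) ≡ c * ∑[ i < n ] f i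
∑-*ˡ c f = sym (*-distribˡ-sum c f)

∑-zero : ∀ {n} (f : Fin n → ℕ) → (∀ i → f i ≡ 0) → ∑[ i < n ] f i ≡ 0
∑-zero {n} f f≡0 = sum-cong-≗ f≡0 ∙ sum-replicate-zero n

∑-one : ∀ n → ∑[ i < n ] 1 ≡ n
∑-one zero = refl
∑-one (suc n) = cong suc (∑-one n)

∑-𝟙≤ : ∀ {n} (p : Fin n → Bool) → ∑[ i < n ] 𝟙 (p i) ≤ n
∑-𝟙≤ {zero} p = z≤n
∑-𝟙≤ {suc n} p = +-mono-≤ (𝟙≤1 (p zero)) (∑-𝟙≤ (λ i → p (suc i)))

∑-𝟙-+-∑-𝟙-not : ∀ {n} (p : Fin n → Bool) → ∑[ i < n ] 𝟙 (p i) + ∑[ i < n ] 𝟙 (not (p i)) ≡ n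
∑-𝟙-+-∑-𝟙-not {n} p = sym (∑-distrib-+ (λ i → 𝟙 (p i)) (λ i → 𝟙 (not (p i)))) ∙ sum-cong-≗ (λ i → 𝟙-+-𝟙-not (p i)) ∙ ∑-one n

∑-by-bool : ∀ {n} (p : Fin n → Bool) (G : Bool → ℕ) →
  ∑[ i < n ] G (p i) ≡ (∑[ i < n ] 𝟙 (p i)) * G true + (∑[ i < n ] 𝟙 (not (p i))) * G false
∑-by-bool p G = sum-cong-≗ (λ i → split (p i))
  ∙ ∑-distrib-+ (λ i → 𝟙 (p i) * G true) (λ i → 𝟙 (not (p i)) * G false)
  ∙ sym (cong₂ _+_ (*-distribʳ-sum (G true) (λ i → 𝟙 (p i))) (*-distribʳ-sum (G false) (λ i → 𝟙 (not (p i)))))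
  where
  split : ∀ b → G b ≡ 𝟙 b * G true + 𝟙 (not b) * G false
  split true = sym (+-identityʳ _ ∙ +-identityʳ _)
  split false = sym (+-identityʳ _)

∑-single : ∀ {n} (f : Fin n → ℕ) a → (∀ i → i ≢ a → f i ≡ 0) → ∑[ i < n ] f i ≡ f a
∑-single f zero f≡0 = cong (f zero +_) (∑-zero _ (λ i → f≡0 (suc i) λ ())) ∙ +-identityʳ _
∑-single f (suc a) f≡0 rewrite f≡0 zero (λ ()) =
  ∑-single (λ i → f (suc i)) a (λ i i≢a → f≡0 (suc i) (λ e → i≢a (suc-injectiveᶠ e)))

∑-update : ∀ {n} (f g : Fin n → ℕ) a → (∀ i → i ≢ a → f i ≡ g i) →
  ∑[ i < n ] f i + g a ≡ ∑[ i < n ] g i + f a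
∑-update {suc n} f g zero f≡g rewrite sum-cong-≗ (λ i → f≡g (suc i) λ ()) =
  solve 3 (λ a b c → a :+ b :+ c := c :+ b :+ a) refl (f zero) (∑[ i < n ] g (suc i)) (g zero)
∑-update {suc n} f g (suc a) f≡g rewrite f≡g zero (λ ()) =
  +-assoc (g zero) _ _
  ∙ cong (g zero +_) (∑-update (λ i → f (suc i)) (λ i → g (suc i)) a (λ i i≢a → f≡g (suc i) (λ e → i≢a (suc-injectiveᶠ e))))
  ∙ sym (+-assoc (g zero) _ _)

∑-update₂ : ∀ {n} (f g : Fin n → ℕ) a b → a ≢ b → (∀ i → i ≢ a → i ≢ b → f i ≡ g i) →
  ∑[ i < n ] f i + g a + g b ≡ ∑[ i < n ] g i + f a + f b
∑-update₂ {n} f g a b a≢b f≡g = begin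
  ∑[ i < n ] f i + g a + g b  ≡⟨ cong (λ z → ∑[ i < n ] f i + z + g b) (sym h-at-a) ⟩
  ∑[ i < n ] f i + h a + g b  ≡⟨ cong (_+ g b) (∑-update f h a (λ i i≢a → sym (h-off-a i i≢a))) ⟩
  ∑[ i < n ] h i + f a + g b  ≡⟨ +-comm-middle (∑[ i < n ] h i) (f a) (g b) ⟩
  ∑[ i < n ] h i + g b + f a  ≡⟨ cong (_+ f a) (∑-update h g b h≡g-off-b) ⟩
  ∑[ i < n ] g i + h b + f a  ≡⟨ cong (λ z → ∑[ i < n ] g i + z + f a) (h-off-a b (λ e → a≢b (sym e))) ⟩
  ∑[ i < n ] g i + f b + f a  ≡⟨ +-comm-middle (∑[ i < n ] g i) (f b) (f a) ⟩
  ∑[ i < n ] g i + f a + f b  ∎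
  where
  h : Fin n → ℕ
  h i = if does (i ≟ᶠ a) then g a else f i
  h-at-a : h a ≡ g a
  h-at-a rewrite dec-true (a ≟ᶠ a) refl = refl
  h-off-a : ∀ i → i ≢ a → h i ≡ f i
  h-off-a i i≢a rewrite dec-false (i ≟ᶠ a) i≢a = refl
  h≡g-off-b : ∀ i → i ≢ b → h i ≡ g i
  h≡g-off-b i i≢b with i ≟ᶠ a
  ... | yes refl = refl
  ... | no i≢a = f≡g i i≢a i≢b
  +-comm-middle : ∀ x y z → x + y + z ≡ x + z + y
  +-comm-middle x y z = solve 3 (λ x y z → x :+ y :+ z := x :+ z :+ y) refl x y z

sumBelow : ℕ → (ℕ → ℕ) → ℕ
sumBelow d g = ∑[ i < d ] g (toℕ i)

sumBelow-cong : ∀ d {g h : ℕ → ℕ} → (∀ k → k < d → g k ≡ h k) → sumBelow d g ≡ sumBelow d h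
sumBelow-cong d g≡h = sum-cong-≗ {d} (λ i → g≡h (toℕ i) (toℕ<n i))

sumBelow-+ : ∀ d (g h : ℕ → ℕ) → sumBelow d (λ k → g k + h k) ≡ sumBelow d g + sumBelow d h
sumBelow-+ d g h = ∑-distrib-+ {d} (λ i → g (toℕ i)) (λ i → h (toℕ i))

sumBelow-*ˡ : ∀ d c (g : ℕ → ℕ) → sumBelow d (λ k → c * g k) ≡ c * sumBelow d g
sumBelow-*ˡ d c g = ∑-*ˡ {d} c (λ i → g (toℕ i))

sumBelow-zero : ∀ d (g : ℕ → ℕ) → (∀ k → k < d → g k ≡ 0) → sumBelow d g ≡ 0
sumBelow-zero d g g≡0 = ∑-zero {d} (λ i → g (toℕ i)) (λ i → g≡0 (toℕ i) (toℕ<n i))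

sumBelow-last : ∀ d (g : ℕ → ℕ) → sumBelow (suc d) g ≡ sumBelow d g + g d
sumBelow-last d g = sum-init-last {d} (λ i → g (toℕ i))
  ∙ cong₂ _+_ (sum-cong-≗ {d} (λ i → cong g (toℕ-inject₁ i))) (cong g (toℕ-fromℕ d))

sumBelow-comm : ∀ d e (g : ℕ → ℕ → ℕ) →
  sumBelow d (λ i → sumBelow e (λ j → g i j)) ≡ sumBelow e (λ j → sumBelow d (λ i → g i j))
sumBelow-comm d e g = ∑-comm {d} {e} (λ i j → g (toℕ i) (toℕ j))

sumBelow-extend : ∀ d d′ (g : ℕ → ℕ) → d ≤ d′ → (∀ k → d ≤ k → k < d′ → g k ≡ 0) → sumBelow d g ≡ sumBelow d′ g
sumBelow-extend zero zero g _ _ = refl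
sumBelow-extend d (suc d′) g d≤ g≡0 with m≤n⇒m<n∨m≡n d≤
... | inj₂ refl = refl
... | inj₁ (s≤s d≤d′) =
  sumBelow-extend d d′ g d≤d′ (λ k d≤k k<d′ → g≡0 k d≤k (m<n⇒m<1+n k<d′))
  ∙ sym (+-identityʳ _) ∙ cong (sumBelow d′ g +_) (sym (g≡0 d′ d≤d′ ≤-refl)) ∙ sym (sumBelow-last d′ g)

sumBelow-indicator : ∀ d a (h : ℕ → ℕ) → a < d → sumBelow d (λ e → 𝟙 (a ≡ᵇ e) * h e) ≡ h a
sumBelow-indicator (suc d) zero h _ =
  cong₂ _+_ (+-identityʳ (h 0)) (sumBelow-zero d _ (λ _ _ → refl)) ∙ +-identityʳ _
sumBelow-indicator (suc d) (suc a) h (s≤s a<d) = sumBelow-indicator d a (λ e → h (suc e)) a<d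

sum-tabulate : ∀ {n} (f : Fin n → ℕ) → sum (tabulate f) ≡ ∑[ i < n ] f i
sum-tabulate {zero} f = refl
sum-tabulate {suc n} f = cong (f zero +_) (sum-tabulate (λ i → f (suc i)))

sum-allFin : ∀ n (f : Fin n → ℕ) → sum (map f (allFin n)) ≡ ∑[ i < n ] f i
sum-allFin n f = cong sum (map-tabulate (λ i → i) f) ∙ sum-tabulate f

sum-applyUpTo : ∀ {A : Set} (g : ℕ → A) (h : A → ℕ) d → sum (map h (applyUpTo g d)) ≡ sumBelow d (λ k → h (g k))
sum-applyUpTo g h zero = refl
sum-applyUpTo g h (suc d) = cong (h (g 0) +_) (sum-applyUpTo (λ k → g (suc k)) h d)

module _ {A : Set} where

  sum-map-cong : ∀ (xs : List A) {f g : A → ℕ} → (∀ x → x ∈ xs → f x ≡ g x) → sum (map f xs) ≡ sum (map g xs)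
  sum-map-cong [] f≡g = refl
  sum-map-cong (x ∷ xs) f≡g = cong₂ _+_ (f≡g x (here refl)) (sum-map-cong xs (λ y y∈ → f≡g y (there y∈)))

  sum-map-+ : ∀ (xs : List A) (f g : A → ℕ) → sum (map (λ x → f x + g x) xs) ≡ sum (map f xs) + sum (map g xs)
  sum-map-+ [] f g = refl
  sum-map-+ (x ∷ xs) f g rewrite sum-map-+ xs f g = solve 4
    (λ a b c d → a :+ b :+ (c :+ d) := a :+ c :+ (b :+ d)) refl (f x) (g x) (sum (map f xs)) (sum (map g xs))

  sum-map-*ˡ : ∀ (xs : List A) c (f : A → ℕ) → sum (map (λ x → c * f x) xs) ≡ c * sum (map f xs)
  sum-map-*ˡ [] c f = sym (*-zeroʳ c)
  sum-map-*ˡ (x ∷ xs) c f rewrite sum-map-*ˡ xs c f = sym (*-distribˡ-+ c (f x) _)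

  sum-map-zero : ∀ (xs : List A) → sum (map (λ _ → 0) xs) ≡ 0
  sum-map-zero [] = refl
  sum-map-zero (x ∷ xs) = sum-map-zero xs

  sum-map-sumBelow : ∀ (xs : List A) d (g : A → ℕ → ℕ) →
    sum (map (λ x → sumBelow d (g x)) xs) ≡ sumBelow d (λ k → sum (map (λ x → g x k) xs))
  sum-map-sumBelow [] d g = sym (sumBelow-zero d _ (λ _ _ → refl))
  sum-map-sumBelow (x ∷ xs) d g rewrite sum-map-sumBelow xs d g = sym (sumBelow-+ d (g x) (λ k → sum (map (λ x → g x k) xs)))

  sum-filter : ∀ {P : A → Set} (P? : ∀ x → Dec (P x)) (xs : List A) (h : A → ℕ) →
    sum (map h (filter P? xs)) ≡ sum (map (λ x → 𝟙 (does (P? x)) * h x) xs)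
  sum-filter P? [] h = refl
  sum-filter P? (x ∷ xs) h with does (P? x)
  ... | true = cong₂ _+_ (sym (+-identityʳ (h x))) (sum-filter P? xs h)
  ... | false = sum-filter P? xs h

  sum-map-∘ : ∀ {B : Set} (g : A → B) (h : B → ℕ) (xs : List A) → sum (map h (map g xs)) ≡ sum (map (λ x → h (g x)) xs)
  sum-map-∘ g h [] = refl
  sum-map-∘ g h (x ∷ xs) = cong (h (g x) +_) (sum-map-∘ g h xs)

  sum-concatMap : ∀ {B : Set} (f : A → List B) (xs : List A) (h : B → ℕ) →
    sum (map h (concatMap f xs)) ≡ sum (map (λ x → sum (map h (f x))) xs)
  sum-concatMap f [] h = refl
  sum-concatMap f (x ∷ xs) h = cong sum (map-++ h (f x) (concatMap f xs)) ∙ sum-++ (map h (f x)) _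
    ∙ cong (sum (map h (f x)) +_) (sum-concatMap f xs h)

  sum-map-unique : ∀ {xs ys : List A} → Unique xs → Unique ys → (∀ {x} → x ∈ xs → x ∈ ys) → (∀ {x} → x ∈ ys → x ∈ xs) →
    ∀ (h : A → ℕ) → sum (map h xs) ≡ sum (map h ys)
  sum-map-unique xs! ys! xs⊆ys ys⊆xs h = sum-↭ (↭.map⁺ h (∼bag⇒↭ (unique∧set⇒bag xs! ys! (mk⇔ xs⊆ys ys⊆xs))))

module _ {A : Set} (p : A → Bool) where

  foldr-∧-true⇒ : ∀ {xs} → foldr (λ x b → p x ∧ b) true xs ≡ true → ∀ {x} → x ∈ xs → p x ≡ true
  foldr-∧-true⇒ {y ∷ xs} all-true (here refl) with p y
  ... | true = refl
  foldr-∧-true⇒ {y ∷ xs} all-true (there x∈xs) with p y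
  ... | true = foldr-∧-true⇒ all-true x∈xs

  foldr-∧-true⇐ : ∀ xs → (∀ {x} → x ∈ xs → p x ≡ true) → foldr (λ x b → p x ∧ b) true xs ≡ true
  foldr-∧-true⇐ [] _ = refl
  foldr-∧-true⇐ (x ∷ xs) all-true rewrite all-true (here refl) = foldr-∧-true⇐ xs (λ x∈xs → all-true (there x∈xs))

<ᵇ-true⇒< : ∀ {m n} → (m <ᵇ n) ≡ true → m < n
<ᵇ-true⇒< {m} {n} eq = <ᵇ⇒< m n (subst T (sym eq) _)

<ᵇ-false⇒≥ : ∀ {m n} → (m <ᵇ n) ≡ false → n ≤ m
<ᵇ-false⇒≥ eq = ≮⇒≥ (λ m<n → subst T eq (<⇒<ᵇ m<n))

<⇒<ᵇ-true : ∀ {m n} → m < n → (m <ᵇ n) ≡ true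
<⇒<ᵇ-true {m} {n} m<n with m <ᵇ n | <⇒<ᵇ m<n
... | true | _ = refl

≥⇒<ᵇ-false : ∀ {m n} → n ≤ m → (m <ᵇ n) ≡ false
≥⇒<ᵇ-false {m} {n} n≤m with m <ᵇ n in eq
... | false = refl
... | true = contradiction (<ᵇ-true⇒< eq) (≤⇒≯ n≤m)

∧-true : ∀ {a b} → (a ∧ b) ≡ true → a ≡ true × b ≡ true
∧-true {true} {true} _ = refl , refl

does-true⇒ : ∀ {P : Set} (d : Dec P) → does d ≡ true → P
does-true⇒ (yes p) _ = p

count≡sum-𝟙 : ∀ {A : Set} (p : A → Bool) xs → count p xs ≡ sum (map (λ x → 𝟙 (p x)) xs)
count≡sum-𝟙 p [] = refl
count≡sum-𝟙 p (x ∷ xs) with p x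
... | true = cong suc (count≡sum-𝟙 p xs)
... | false = count≡sum-𝟙 p xs

does-≟-true : ∀ b → does (b Bool.≟ true) ≡ b
does-≟-true true = refl
does-≟-true false = refl

choose : ℕ → ℕ → ℕ
choose n zero = 1
choose zero (suc k) = 0
choose (suc n) (suc k) = choose n k + choose n (suc k)

choose-above : ∀ n k → n < k → choose n k ≡ 0
choose-above zero (suc k) _ = refl
choose-above (suc n) (suc k) (s≤s n<k)
  rewrite choose-above n k n<k | choose-above n (suc k) (m<n⇒m<1+n n<k) = refl

choose-1 : ∀ n → choose n 1 ≡ n
choose-1 zero = refl
choose-1 (suc n) = cong suc (choose-1 n)

choose-absorb : ∀ n k → suc k * choose (suc n) (suc k) ≡ suc n * choose n k
choose-absorb zero zero = refl
choose-absorb zero (suc k) = *-zeroʳ (suc (suc k))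
choose-absorb (suc n) zero = +-identityʳ _ ∙ cong (λ z → suc (suc z)) (choose-1 n) ∙ sym (*-identityʳ (suc (suc n)))
choose-absorb (suc n) (suc k) = begin
  suc (suc k) * (A + B)                          ≡⟨ *-distribˡ-+ (suc (suc k)) A B ⟩
  A + suc k * A + suc (suc k) * B               ≡⟨ cong₂ (λ x y → A + x + y) (choose-absorb n k) (choose-absorb n (suc k)) ⟩
  A + suc n * choose n k + suc n * choose n (suc k) ≡⟨ +-assoc A _ _ ∙ cong (A +_) (sym (*-distribˡ-+ (suc n) (choose n k) (choose n (suc k)))) ⟩
  A + suc n * A                                  ∎
  where
  A = choose (suc n) (suc k)
  B = choose (suc n) (suc (suc k))

choose-complement : ∀ n k → (n ∸ k) * choose n k ≡ suc k * choose n (suc k)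
choose-complement n k with k ≤? n
... | no k≰n rewrite choose-above n k (≰⇒> k≰n) | choose-above n (suc k) (m<n⇒m<1+n (≰⇒> k≰n)) =
  *-zeroʳ (n ∸ k) ∙ sym (*-zeroʳ (suc k))
... | yes k≤n = +-cancelˡ-≡ (suc k * C) _ _ (begin
  suc k * C + (n ∸ k) * C        ≡⟨ sym (*-distribʳ-+ C (suc k) (n ∸ k)) ⟩
  suc (k + (n ∸ k)) * C          ≡⟨ cong (λ z → suc z * C) (m+[n∸m]≡n k≤n) ⟩
  suc n * C                      ≡⟨ sym (choose-absorb n k) ⟩
  suc k * (C + C′)               ≡⟨ *-distribˡ-+ (suc k) C C′ ⟩
  suc k * C + suc k * C′         ∎)
  where
  C = choose n k
  C′ = choose n (suc k)

choose-pred-absorb : ∀ n k → n * choose (n ∸ 1) k ≡ suc k * choose n (suc k)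
choose-pred-absorb zero k = sym (*-zeroʳ (suc k))
choose-pred-absorb (suc n) k = sym (choose-absorb n k)

choose-shifted-complement : ∀ q n k → ((q + n) ∸ k) * choose n k ≡ q * choose n k + suc k * choose n (suc k)
choose-shifted-complement q n k with k ≤? n
... | yes k≤n = cong (_* choose n k) (+-∸-assoc q k≤n) ∙ *-distribʳ-+ (choose n k) q (n ∸ k)
  ∙ cong (q * choose n k +_) (choose-complement n k)
... | no k≰n rewrite choose-above n k (≰⇒> k≰n) | choose-above n (suc k) (m<n⇒m<1+n (≰⇒> k≰n))
  | *-zeroʳ ((q + n) ∸ k) | *-zeroʳ q | *-zeroʳ (suc k) = refl

binomial-theorem : ∀ x n d → n < d → sumBelow d (λ k → choose n k * x ^ k) ≡ (1 + x) ^ n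
binomial-theorem x zero (suc d) _ = cong suc (sumBelow-zero d _ (λ _ _ → refl))
binomial-theorem x (suc n) (suc d) (s≤s n<d) = begin
  1 * 1 + sumBelow d (λ k → (choose n k + choose n (suc k)) * x ^ suc k)
    ≡⟨ cong suc (sumBelow-cong d (λ k _ → *-distribʳ-+ (x ^ suc k) (choose n k) (choose n (suc k)))
        ∙ sumBelow-+ d (λ k → choose n k * x ^ suc k) (λ k → choose n (suc k) * x ^ suc k)) ⟩
  1 + (sumBelow d (λ k → choose n k * x ^ suc k) + sumBelow d (λ k → choose n (suc k) * x ^ suc k))
    ≡⟨ cong (λ z → 1 + (z + sumBelow d (λ k → choose n (suc k) * x ^ suc k))) shift ⟩
  1 + (x * (1 + x) ^ n + sumBelow d (λ k → choose n (suc k) * x ^ suc k))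
    ≡⟨ cong suc (+-comm (x * (1 + x) ^ n) _) ⟩
  sumBelow (suc d) (λ k → choose n k * x ^ k) + x * (1 + x) ^ n
    ≡⟨ cong (_+ x * (1 + x) ^ n) (binomial-theorem x n (suc d) (m<n⇒m<1+n n<d)) ⟩
  (1 + x) ^ n + x * (1 + x) ^ n ∎
  where
  shift : sumBelow d (λ k → choose n k * x ^ suc k) ≡ x * (1 + x) ^ n
  shift = sumBelow-cong d (λ k _ → solve 3 (λ c x p → c :* (x :* p) := x :* (c :* p)) refl (choose n k) x (x ^ k))
    ∙ sumBelow-*ˡ d x (λ k → choose n k * x ^ k) ∙ cong (x *_) (binomial-theorem x n d n<d)

-- shiftedChoose n q e is the coefficient of x^e in x^q (1 + x)^n.
shiftedChoose : ℕ → ℕ → ℕ → ℕ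
shiftedChoose n zero e = choose n e
shiftedChoose n (suc q) zero = 0
shiftedChoose n (suc q) (suc e) = shiftedChoose n q e

shiftedChoose-below : ∀ n q e → e < q → shiftedChoose n q e ≡ 0
shiftedChoose-below n (suc q) zero _ = refl
shiftedChoose-below n (suc q) (suc e) (s≤s e<q) = shiftedChoose-below n q e e<q

shiftedChoose-diag : ∀ n q → shiftedChoose n q q ≡ 1
shiftedChoose-diag n zero = refl
shiftedChoose-diag n (suc q) = shiftedChoose-diag n q

shiftedChoose-+ : ∀ n q k → shiftedChoose n q (q + k) ≡ choose n k
shiftedChoose-+ n zero k = refl
shiftedChoose-+ n (suc q) k = shiftedChoose-+ n q k

shiftedChoose-suc : ∀ n q k → shiftedChoose n q (suc (q + k)) ≡ choose n (suc k)
shiftedChoose-suc n zero k = refl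
shiftedChoose-suc n (suc q) k = shiftedChoose-suc n q k

shiftedChoose-sum : ∀ x n q d → q + n < d → sumBelow d (λ e → shiftedChoose n q e * x ^ e) ≡ x ^ q * (1 + x) ^ n
shiftedChoose-sum x n zero d q+n<d = binomial-theorem x n d q+n<d ∙ sym (+-identityʳ _)
shiftedChoose-sum x n (suc q) (suc d) (s≤s q+n<d) = begin
  sumBelow d (λ e → shiftedChoose n q e * x ^ suc e)
    ≡⟨ sumBelow-cong d (λ e _ → solve 3 (λ c x p → c :* (x :* p) := x :* (c :* p)) refl (shiftedChoose n q e) x (x ^ e)) ⟩
  sumBelow d (λ e → x * (shiftedChoose n q e * x ^ e))
    ≡⟨ sumBelow-*ˡ d x (λ e → shiftedChoose n q e * x ^ e) ∙ cong (x *_) (shiftedChoose-sum x n q d q+n<d) ⟩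
  x * (x ^ q * (1 + x) ^ n)
    ≡⟨ sym (*-assoc x _ _) ⟩
  x * x ^ q * (1 + x) ^ n ∎

previous : (ℕ → ℕ) → ℕ → ℕ
previous g zero = 0
previous g (suc k) = g k

previous-shiftedChoose-vanishes : ∀ (c : ℕ → ℕ) n q e → e ≤ q → previous (λ e′ → c e′ * shiftedChoose n q e′) e ≡ 0
previous-shiftedChoose-vanishes c n q zero _ = refl
previous-shiftedChoose-vanishes c n q (suc e) e<q = cong (c e *_) (shiftedChoose-below n q e e<q) ∙ *-zeroʳ (c e)

data Offset (q : ℕ) : ℕ → Set where
  below : ∀ {e} → e < q → Offset q e
  diagonal : Offset q q
  beyond : ∀ k → Offset q (suc (q + k))

offset : ∀ q e → Offset q e
offset q e with compare q e
... | less q k = beyond k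
... | equal q = diagonal
... | greater e k = below (s≤s (m≤m+n e k))

shiftedChoose-step-beyond : ∀ r q n k → r ≤ 1 →
  suc (2 * suc (q + k)) * shiftedChoose n q (suc (q + k)) + 2 * ((r + (q + q) + n) ∸ (q + k)) * shiftedChoose n q (q + k)
  ≡ shiftedChoose n (r + q) (suc (q + k)) + (r + (q + q)) * shiftedChoose (suc n) q (suc (q + k)) + 4 * n * shiftedChoose (n ∸ 1) q (q + k)
shiftedChoose-step-beyond r q n k r≤1 = begin
  suc (2 * suc (q + k)) * shiftedChoose n q (suc (q + k)) + 2 * ((r + (q + q) + n) ∸ (q + k)) * shiftedChoose n q (q + k)
    ≡⟨ cong₂ (λ a b → suc (2 * suc (q + k)) * a + 2 * ((r + (q + q) + n) ∸ (q + k)) * b) (shiftedChoose-suc n q k) (shiftedChoose-+ n q k) ⟩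
  suc (2 * suc (q + k)) * X + 2 * ((r + (q + q) + n) ∸ (q + k)) * Y
    ≡⟨ cong (λ z → suc (2 * suc (q + k)) * X + 2 * z * Y) drop-q ⟩
  suc (2 * suc (q + k)) * X + 2 * ((r + q + n) ∸ k) * Y
    ≡⟨ cong (suc (2 * suc (q + k)) * X +_) (*-assoc 2 ((r + q + n) ∸ k) Y ∙ cong (2 *_) (choose-shifted-complement (r + q) n k)) ⟩
  suc (2 * suc (q + k)) * X + 2 * ((r + q) * Y + suc k * X)
    ≡⟨ close r r≤1 ⟩
  shiftedChoose n (r + q) (suc (q + k)) + (r + (q + q)) * (Y + X) + 4 * (suc k * X)
    ≡⟨ cong₂ (λ a b → shiftedChoose n (r + q) (suc (q + k)) + (r + (q + q)) * a + 4 * b)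
         (sym (shiftedChoose-suc (suc n) q k)) (sym (choose-pred-absorb n k) ∙ cong (n *_) (sym (shiftedChoose-+ (n ∸ 1) q k))) ⟩
  shiftedChoose n (r + q) (suc (q + k)) + (r + (q + q)) * shiftedChoose (suc n) q (suc (q + k)) + 4 * (n * shiftedChoose (n ∸ 1) q (q + k))
    ≡⟨ cong (shiftedChoose n (r + q) (suc (q + k)) + (r + (q + q)) * shiftedChoose (suc n) q (suc (q + k)) +_) (sym (*-assoc 4 n _)) ⟩
  shiftedChoose n (r + q) (suc (q + k)) + (r + (q + q)) * shiftedChoose (suc n) q (suc (q + k)) + 4 * n * shiftedChoose (n ∸ 1) q (q + k) ∎
  where
  X = choose n (suc k)
  Y = choose n k
  drop-q : (r + (q + q) + n) ∸ (q + k) ≡ (r + q + n) ∸ k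
  drop-q = cong (_∸ (q + k)) (solve 3 (λ r q n → r :+ (q :+ q) :+ n := q :+ (r :+ q :+ n)) refl r q n)
    ∙ [m+n]∸[m+o]≡n∸o q (r + q + n) k
  close : ∀ r → r ≤ 1 → suc (2 * suc (q + k)) * X + 2 * ((r + q) * Y + suc k * X)
    ≡ shiftedChoose n (r + q) (suc (q + k)) + (r + (q + q)) * (Y + X) + 4 * (suc k * X)
  close zero _ rewrite shiftedChoose-suc n q k = solve 4 (λ q k X Y →
      (con 1 :+ con 2 :* (con 1 :+ (q :+ k))) :* X :+ con 2 :* (q :* Y :+ (con 1 :+ k) :* X)
      := X :+ (q :+ q) :* (Y :+ X) :+ con 4 :* ((con 1 :+ k) :* X)) refl q k X Y
  close (suc zero) _ rewrite shiftedChoose-+ n q k = solve 4 (λ q k X Y →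
      (con 1 :+ con 2 :* (con 1 :+ (q :+ k))) :* X :+ con 2 :* ((con 1 :+ q) :* Y :+ (con 1 :+ k) :* X)
      := Y :+ (con 1 :+ (q :+ q)) :* (Y :+ X) :+ con 4 :* ((con 1 :+ k) :* X)) refl q k X Y
  close (suc (suc _)) (s≤s ())

-- The recurrence of the excedance weights, applied to the coefficients of x^q (1 + x)^n with m = r + 2q.
shiftedChoose-step : ∀ r q n e → r ≤ 1 →
  suc (2 * e) * shiftedChoose n q e + previous (λ e′ → 2 * ((r + (q + q) + n) ∸ e′) * shiftedChoose n q e′) e
  ≡ shiftedChoose n (r + q) e + (r + (q + q)) * shiftedChoose (suc n) q e + 4 * n * shiftedChoose (n ∸ 1) (suc q) e
shiftedChoose-step r q n e r≤1 with offset q e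
... | below e<q
  rewrite shiftedChoose-below n q e e<q | shiftedChoose-below (suc n) q e e<q
        | shiftedChoose-below (n ∸ 1) (suc q) e (m<n⇒m<1+n e<q)
        | shiftedChoose-below n (r + q) e (≤-trans e<q (m≤n+m q r))
        | previous-shiftedChoose-vanishes (λ e′ → 2 * ((r + (q + q) + n) ∸ e′)) n q e (<⇒≤ e<q)
        | *-zeroʳ (suc (2 * e)) | *-zeroʳ (r + (q + q)) | *-zeroʳ (4 * n) = refl
... | diagonal
  rewrite shiftedChoose-diag n q | shiftedChoose-diag (suc n) q
        | shiftedChoose-below (n ∸ 1) (suc q) q ≤-refl
        | previous-shiftedChoose-vanishes (λ e′ → 2 * ((r + (q + q) + n) ∸ e′)) n q q ≤-refl
        | *-zeroʳ (4 * n) = diag r r≤1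
  where
  diag : ∀ r → r ≤ 1 → suc (2 * q) * 1 + 0 ≡ shiftedChoose n (r + q) q + (r + (q + q)) * 1 + 0
  diag zero _ rewrite shiftedChoose-diag n q =
    solve 1 (λ q → (con 1 :+ con 2 :* q) :* con 1 :+ con 0 := con 1 :+ (q :+ q) :* con 1 :+ con 0) refl q
  diag (suc zero) _ rewrite shiftedChoose-below n (suc q) q ≤-refl =
    solve 1 (λ q → (con 1 :+ con 2 :* q) :* con 1 :+ con 0 := con 0 :+ (con 1 :+ (q :+ q)) :* con 1 :+ con 0) refl q
  diag (suc (suc _)) (s≤s ())
... | beyond k = shiftedChoose-step-beyond r q n k r≤1

data Halves : ℕ → Set where
  halves : ∀ r q → r ≤ 1 → Halves (r + (q + q))

halves-of : ∀ m → Halves m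
halves-of zero = halves 0 0 z≤n
halves-of (suc zero) = halves 1 0 ≤-refl
halves-of (suc (suc m)) with halves-of m
... | halves r q r≤1 = subst Halves (solve 2 (λ r q → r :+ ((con 1 :+ q) :+ (con 1 :+ q)) := con 2 :+ (r :+ (q :+ q))) refl r q)
  (halves r (suc q) r≤1)

⌊r+2q/2⌋≡q : ∀ r q → r ≤ 1 → ⌊ r + (q + q) /2⌋ ≡ q
⌊r+2q/2⌋≡q zero q _ = sym (n≡⌊n+n/2⌋ q)
⌊r+2q/2⌋≡q (suc zero) q _ = sym (n≡⌈n+n/2⌉ q)
⌊r+2q/2⌋≡q (suc (suc _)) q (s≤s ())

⌊1+r+2q/2⌋≡r+q : ∀ r q → r ≤ 1 → ⌊ suc (r + (q + q)) /2⌋ ≡ r + q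
⌊1+r+2q/2⌋≡r+q zero q _ = sym (n≡⌈n+n/2⌉ q)
⌊1+r+2q/2⌋≡r+q (suc zero) q _ = cong suc (sym (n≡⌊n+n/2⌋ q))
⌊1+r+2q/2⌋≡r+q (suc (suc _)) q (s≤s ())

previous-cong : ∀ {g h : ℕ → ℕ} → (∀ k → g k ≡ h k) → ∀ k → previous g k ≡ previous h k
previous-cong g≡h zero = refl
previous-cong g≡h (suc k) = g≡h k

basisCoeff : ℕ → ℕ → ℕ → ℕ
basisCoeff n m e = shiftedChoose (n ∸ m) ⌊ m /2⌋ e

basisCoeff-sum : ∀ x n m → m ≤ n → sumBelow (suc n) (λ e → basisCoeff n m e * x ^ e) ≡ x ^ ⌊ m /2⌋ * (1 + x) ^ (n ∸ m)
basisCoeff-sum x n m m≤n = shiftedChoose-sum x (n ∸ m) ⌊ m /2⌋ (suc n)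
  (s≤s (≤-trans (+-monoˡ-≤ (n ∸ m) (⌊n/2⌋≤n m)) (≤-reflexive (m+[n∸m]≡n m≤n))))

basisCoeff-step-halves : ∀ {m} → Halves m → ∀ N e →
  suc (2 * e) * basisCoeff (m + N) m e + previous (λ e′ → 2 * ((m + N) ∸ e′) * basisCoeff (m + N) m e′) e
  ≡ basisCoeff (suc (m + N)) (suc m) e + m * basisCoeff (suc (m + N)) m e + 4 * ((m + N) ∸ m) * basisCoeff (suc (m + N)) (suc (suc m)) e
basisCoeff-step-halves (halves r q r≤1) N e = begin
  suc (2 * e) * basisCoeff (m + N) m e + previous (λ e′ → 2 * ((m + N) ∸ e′) * basisCoeff (m + N) m e′) e
    ≡⟨ cong₂ _+_ (cong (suc (2 * e) *_) (b₀ e)) (previous-cong (λ e′ → cong (2 * ((m + N) ∸ e′) *_) (b₀ e′)) e) ⟩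
  suc (2 * e) * shiftedChoose N q e + previous (λ e′ → 2 * ((m + N) ∸ e′) * shiftedChoose N q e′) e
    ≡⟨ shiftedChoose-step r q N e r≤1 ⟩
  shiftedChoose N (r + q) e + m * shiftedChoose (suc N) q e + 4 * N * shiftedChoose (N ∸ 1) (suc q) e
    ≡⟨ sym (cong₂ _+_ (cong₂ (λ a b → a + m * b) b₁ b₂) (cong₂ (λ a b → 4 * a * b) (m+n∸m≡n m N) b₃)) ⟩
  basisCoeff (suc (m + N)) (suc m) e + m * basisCoeff (suc (m + N)) m e + 4 * ((m + N) ∸ m) * basisCoeff (suc (m + N)) (suc (suc m)) e ∎
  where
  m = r + (q + q)
  b₀ : ∀ e → basisCoeff (m + N) m e ≡ shiftedChoose N q e
  b₀ e = cong₂ (λ a b → shiftedChoose a b e) (m+n∸m≡n m N) (⌊r+2q/2⌋≡q r q r≤1)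
  b₁ : basisCoeff (suc (m + N)) (suc m) e ≡ shiftedChoose N (r + q) e
  b₁ = cong₂ (λ a b → shiftedChoose a b e) (m+n∸m≡n m N) (⌊1+r+2q/2⌋≡r+q r q r≤1)
  b₂ : basisCoeff (suc (m + N)) m e ≡ shiftedChoose (suc N) q e
  b₂ = cong₂ (λ a b → shiftedChoose a b e) (cong (_∸ m) (sym (+-suc m N)) ∙ m+n∸m≡n m (suc N)) (⌊r+2q/2⌋≡q r q r≤1)
  b₃ : basisCoeff (suc (m + N)) (suc (suc m)) e ≡ shiftedChoose (N ∸ 1) (suc q) e
  b₃ = cong₂ (λ a b → shiftedChoose a b e)
    (cong (_∸ suc m) (+-comm m N) ∙ cong (N + m ∸_) (+-comm 1 m) ∙ sym (∸-+-assoc (N + m) m 1) ∙ cong (_∸ 1) (m+n∸n≡m N m))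
    (cong suc (⌊r+2q/2⌋≡q r q r≤1))

basisCoeff-step : ∀ n m e → m ≤ n →
  suc (2 * e) * basisCoeff n m e + previous (λ e′ → 2 * (n ∸ e′) * basisCoeff n m e′) e
  ≡ basisCoeff (suc n) (suc m) e + m * basisCoeff (suc n) m e + 4 * (n ∸ m) * basisCoeff (suc n) (suc (suc m)) e
basisCoeff-step n m e m≤n = subst (λ n → suc (2 * e) * basisCoeff n m e + previous (λ e′ → 2 * (n ∸ e′) * basisCoeff n m e′) e
    ≡ basisCoeff (suc n) (suc m) e + m * basisCoeff (suc n) m e + 4 * (n ∸ m) * basisCoeff (suc n) (suc (suc m)) e)
  (m+[n∸m]≡n m≤n) (basisCoeff-step-halves (halves-of m) (n ∸ m) e)

sumBelow-linear-step : ∀ d a (c t : ℕ → ℕ) (b : ℕ → ℕ → ℕ) e →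
  a * sumBelow d (λ m → t m * b m e) + previous (λ e′ → c e′ * sumBelow d (λ m → t m * b m e′)) e
  ≡ sumBelow d (λ m → t m * (a * b m e + previous (λ e′ → c e′ * b m e′) e))
sumBelow-linear-step d a c t b zero =
  +-identityʳ _ ∙ sym (sumBelow-*ˡ d a (λ m → t m * b m 0))
  ∙ sumBelow-cong d (λ m _ → solve 3 (λ a t b → a :* (t :* b) := t :* (a :* b :+ con 0)) refl a (t m) (b m 0))
sumBelow-linear-step d a c t b (suc e) =
  cong₂ _+_ (sym (sumBelow-*ˡ d a (λ m → t m * b m (suc e)))) (sym (sumBelow-*ˡ d (c e) (λ m → t m * b m e)))
  ∙ sym (sumBelow-+ d (λ m → a * (t m * b m (suc e))) (λ m → c e * (t m * b m e)))
  ∙ sumBelow-cong d (λ m _ → solve 5 (λ a c t b b′ → a :* (t :* b) :+ c :* (t :* b′) := t :* (a :* b :+ c :* b′))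
      refl a (c e) (t m) (b m (suc e)) (b m e))

module Expansion (u t : ℕ → ℕ → ℕ)
  (u-zero : ∀ e → u 0 e ≡ 𝟙 (e ≡ᵇ 0))
  (u-suc : ∀ n e → u (suc n) e ≡ suc (2 * e) * u n e + previous (λ e′ → 2 * (n ∸ e′) * u n e′) e)
  (t-zero : ∀ m → t 0 m ≡ 𝟙 (m ≡ᵇ 0))
  (t-suc : ∀ n m → t (suc n) m ≡ previous (t n) m + m * t n m + previous (previous (λ m′ → 4 * (n ∸ m′) * t n m′)) m)
  where

  t-vanishes : ∀ n m → n < m → t n m ≡ 0
  t-vanishes zero (suc m) _ = t-zero (suc m)
  t-vanishes (suc n) (suc m) (s≤s n<m) = t-suc n (suc m)
    ∙ cong₂ (λ a b → a + suc m * b + previous (λ m′ → 4 * (n ∸ m′) * t n m′) m)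
        (t-vanishes n m n<m) (t-vanishes n (suc m) (m<n⇒m<1+n n<m))
    ∙ cong (_+ previous (λ m′ → 4 * (n ∸ m′) * t n m′) m) (*-zeroʳ (suc m)) ∙ last-vanishes m n<m
    where
    last-vanishes : ∀ m → n < m → previous (λ m′ → 4 * (n ∸ m′) * t n m′) m ≡ 0
    last-vanishes (suc m) (s≤s n≤m) rewrite m≤n⇒m∸n≡0 n≤m = refl

  t-recurrence-sum : ∀ n (c : ℕ → ℕ) →
    sumBelow (suc n) (λ m → t n m * (c (suc m) + m * c m + 4 * (n ∸ m) * c (suc (suc m))))
    ≡ sumBelow (suc (suc n)) (λ m → t (suc n) m * c m)
  t-recurrence-sum n c = begin
    sumBelow (suc n) (λ m → t n m * (c (suc m) + m * c m + 4 * (n ∸ m) * c (suc (suc m))))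
      ≡⟨ sumBelow-cong (suc n) (λ m _ → solve 6 (λ t c₁ c₀ c₂ m d → t :* (c₁ :+ m :* c₀ :+ con 4 :* d :* c₂)
           := t :* c₁ :+ m :* t :* c₀ :+ con 4 :* d :* t :* c₂) refl (t n m) (c (suc m)) (c m) (c (suc (suc m))) m (n ∸ m))
         ∙ sumBelow-+ (suc n) (λ m → t n m * c (suc m) + m * t n m * c m) (λ m → g m * c (suc (suc m)))
         ∙ cong (_+ sumBelow (suc n) (λ m → g m * c (suc (suc m)))) (sumBelow-+ (suc n) (λ m → t n m * c (suc m)) (λ m → m * t n m * c m)) ⟩
    sumBelow (suc n) (λ m → t n m * c (suc m)) + sumBelow (suc n) (λ m → m * t n m * c m) + sumBelow (suc n) (λ m → g m * c (suc (suc m)))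
      ≡⟨ cong₂ (λ a b → sumBelow (suc n) (λ m → t n m * c (suc m)) + a + b) middle-extend last-drop ⟩
    sumBelow (suc (suc n)) (λ m → previous (t n) m * c m) + sumBelow (suc (suc n)) (λ m → m * t n m * c m)
      + sumBelow (suc (suc n)) (λ m → previous (previous g) m * c m)
      ≡⟨ cong (_+ sumBelow (suc (suc n)) (λ m → previous (previous g) m * c m))
           (sym (sumBelow-+ (suc (suc n)) (λ m → previous (t n) m * c m) (λ m → m * t n m * c m)))
         ∙ sym (sumBelow-+ (suc (suc n)) (λ m → previous (t n) m * c m + m * t n m * c m) (λ m → previous (previous g) m * c m)) ⟩
    sumBelow (suc (suc n)) (λ m → previous (t n) m * c m + m * t n m * c m + previous (previous g) m * c m)
      ≡⟨ sumBelow-cong (suc (suc n)) (λ m _ → solve 4 (λ a b d x → a :* x :+ b :* x :+ d :* x := (a :+ b :+ d) :* x)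
           refl (previous (t n) m) (m * t n m) (previous (previous g) m) (c m) ∙ cong (_* c m) (sym (t-suc n m))) ⟩
    sumBelow (suc (suc n)) (λ m → t (suc n) m * c m) ∎
    where
    g : ℕ → ℕ
    g m = 4 * (n ∸ m) * t n m
    middle-extend : sumBelow (suc n) (λ m → m * t n m * c m) ≡ sumBelow (suc (suc n)) (λ m → m * t n m * c m)
    middle-extend = sumBelow-extend (suc n) (suc (suc n)) (λ m → m * t n m * c m) (n≤1+n _) λ where
      m n<m m<2+n → cong (λ z → m * z * c m) (t-vanishes n m n<m) ∙ cong (_* c m) (*-zeroʳ m)
    last-drop : sumBelow (suc n) (λ m → g m * c (suc (suc m))) ≡ sumBelow n (λ m → g m * c (suc (suc m)))
    last-drop = sumBelow-last n (λ m → g m * c (suc (suc m)))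
      ∙ cong (λ z → sumBelow n (λ m → g m * c (suc (suc m))) + 4 * z * t n n * c (suc (suc n))) (n∸n≡0 n)
      ∙ +-identityʳ _

  u-expansion : ∀ n e → u n e ≡ sumBelow (suc n) (λ m → t n m * basisCoeff n m e)
  u-expansion zero zero = u-zero 0 ∙ cong (λ z → z * 1 + 0) (sym (t-zero 0))
  u-expansion zero (suc e) = u-zero (suc e) ∙ sym (cong (_+ 0) (*-zeroʳ (t 0 0)))
  u-expansion (suc n) e = begin
    u (suc n) e
      ≡⟨ u-suc n e ⟩
    suc (2 * e) * u n e + previous (λ e′ → 2 * (n ∸ e′) * u n e′) e
      ≡⟨ cong₂ _+_ (cong (suc (2 * e) *_) (u-expansion n e)) (previous-cong (λ e′ → cong (2 * (n ∸ e′) *_) (u-expansion n e′)) e) ⟩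
    suc (2 * e) * sumBelow (suc n) (λ m → t n m * basisCoeff n m e)
      + previous (λ e′ → 2 * (n ∸ e′) * sumBelow (suc n) (λ m → t n m * basisCoeff n m e′)) e
      ≡⟨ sumBelow-linear-step (suc n) (suc (2 * e)) (λ e′ → 2 * (n ∸ e′)) (t n) (basisCoeff n) e ⟩
    sumBelow (suc n) (λ m → t n m * (suc (2 * e) * basisCoeff n m e + previous (λ e′ → 2 * (n ∸ e′) * basisCoeff n m e′) e))
      ≡⟨ sumBelow-cong (suc n) (λ m m<1+n → cong (t n m *_) (basisCoeff-step n m e (≤-pred m<1+n))) ⟩
    sumBelow (suc n) (λ m → t n m * (basisCoeff (suc n) (suc m) e + m * basisCoeff (suc n) m e
                                       + 4 * (n ∸ m) * basisCoeff (suc n) (suc (suc m)) e))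
      ≡⟨ t-recurrence-sum n (λ m → basisCoeff (suc n) m e) ⟩
    sumBelow (suc (suc n)) (λ m → t (suc n) m * basisCoeff (suc n) m e) ∎

  polynomial-expansion : ∀ n x → sumBelow (suc n) (λ e → u n e * x ^ e)
                      ≡ sumBelow (suc n) (λ m → t n m * (x ^ ⌊ m /2⌋ * (1 + x) ^ (n ∸ m)))
  polynomial-expansion n x = begin
    sumBelow (suc n) (λ e → u n e * x ^ e)
      ≡⟨ sumBelow-cong (suc n) (λ e _ → cong (_* x ^ e) (u-expansion n e) ∙ *-comm _ (x ^ e)
           ∙ sym (sumBelow-*ˡ (suc n) (x ^ e) (λ m → t n m * basisCoeff n m e))) ⟩
    sumBelow (suc n) (λ e → sumBelow (suc n) (λ m → x ^ e * (t n m * basisCoeff n m e)))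
      ≡⟨ sumBelow-comm (suc n) (suc n) (λ e m → x ^ e * (t n m * basisCoeff n m e)) ⟩
    sumBelow (suc n) (λ m → sumBelow (suc n) (λ e → x ^ e * (t n m * basisCoeff n m e)))
      ≡⟨ sumBelow-cong (suc n) (λ m m<1+n →
           sumBelow-cong (suc n) (λ e _ → solve 3 (λ p t c → p :* (t :* c) := t :* (c :* p)) refl (x ^ e) (t n m) (basisCoeff n m e))
           ∙ sumBelow-*ˡ (suc n) (t n m) (λ e → basisCoeff n m e * x ^ e)
           ∙ cong (t n m *_) (basisCoeff-sum x n m (≤-pred m<1+n))) ⟩
    sumBelow (suc n) (λ m → t n m * (x ^ ⌊ m /2⌋ * (1 + x) ^ (n ∸ m))) ∎

iterate : ∀ {m} → (Fin m → Fin m) → ℕ → Fin m → Fin m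
iterate f zero x = x
iterate f (suc k) x = f (iterate f k x)

iterate-+ : ∀ {m} (f : Fin m → Fin m) j k x → iterate f (j + k) x ≡ iterate f j (iterate f k x)
iterate-+ f zero k x = refl
iterate-+ f (suc j) k x = cong f (iterate-+ f j k x)

iterate-cong : ∀ {m} {f g : Fin m → Fin m} → f ≗ g → ∀ k x → iterate f k x ≡ iterate g k x
iterate-cong f≗g zero x = refl
iterate-cong {f = f} f≗g (suc k) x = cong f (iterate-cong f≗g k x) ∙ f≗g _

iterate-injective : ∀ {m} {f : Fin m → Fin m} → Injective _≡_ _≡_ f → ∀ k {x y} → iterate f k x ≡ iterate f k y → x ≡ y
iterate-injective f-inj zero eq = eq
iterate-injective f-inj (suc k) eq = iterate-injective f-inj k (f-inj eq)

module _ {P : ℕ → Set} (P? : ∀ k → Dec (P k)) where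

  first-below : ∀ n → (Σ ℕ λ k → k < n × P k × (∀ j → j < k → ¬ P j)) ⊎ (∀ j → j < n → ¬ P j)
  first-below zero = inj₂ (λ j ())
  first-below (suc n) with first-below n | P? n
  ... | inj₁ (k , k<n , Pk , first) | _ = inj₁ (k , m<n⇒m<1+n k<n , Pk , first)
  ... | inj₂ none | yes Pn = inj₁ (n , ≤-refl , Pn , none)
  ... | inj₂ none | no ¬Pn = inj₂ λ j j<1+n → case m≤n⇒m<n∨m≡n (≤-pred j<1+n) of λ where
    (inj₁ j<n) → none j j<n
    (inj₂ refl) → ¬Pn

  least-witness : ∀ {n} → P n → Σ ℕ λ k → P k × k ≤ n × (∀ j → j < k → ¬ P j)
  least-witness {n} Pn with first-below (suc n)
  ... | inj₁ (k , k<1+n , Pk , first) = k , Pk , ≤-pred k<1+n , first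
  ... | inj₂ none = contradiction Pn (none n ≤-refl)

record Orbit {m} (f : Fin m → Fin m) (x : Fin m) : Set where
  field
    period : ℕ
    period>0 : 0 < period
    period≤m : period ≤ m
    returns : iterate f period x ≡ x
    minimal : ∀ k → 0 < k → k < period → iterate f k x ≢ x

module _ {m} {f : Fin m → Fin m} (f-inj : Injective _≡_ _≡_ f) where

  abstract
    returns-within : ∀ x → Σ ℕ λ L → 0 < L × L ≤ m × iterate f L x ≡ x
    returns-within x with pigeonhole (n<1+n m) (λ (k : Fin (suc m)) → iterate f (toℕ k) x)
    ... | i , j , i<j , eq = toℕ j ∸ toℕ i , m<n⇒0<n∸m i<j , ≤-trans (m∸n≤m (toℕ j) (toℕ i)) (≤-pred (toℕ<n j)) ,
          iterate-injective f-inj (toℕ i) (sym (iterate-+ f (toℕ i) _ x)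
            ∙ cong (λ k → iterate f k x) (+-comm (toℕ i) _ ∙ m∸n+n≡m (<⇒≤ i<j)) ∙ sym eq)

    orbit : ∀ x → Orbit f x
    orbit x with returns-within x
    ... | L , L>0 , L≤m , returns with least-witness (λ k → (0 <? k) ×-dec (iterate f k x ≟ᶠ x)) (L>0 , returns)
    ... | M , (M>0 , returnsM) , M≤L , first = record
      { period = M ; period>0 = M>0 ; period≤m = ≤-trans M≤L L≤m ; returns = returnsM
      ; minimal = λ k k>0 k<M eq → first k k<M (k>0 , eq) }

  module _ (x : Fin m) where
    open Orbit (orbit x)

    iterate-reduce : ∀ k → Σ ℕ λ j → j < period × iterate f k x ≡ iterate f j x
    iterate-reduce zero = 0 , period>0 , refl
    iterate-reduce (suc k) with iterate-reduce k
    ... | j , j<L , eq with m≤n⇒m<n∨m≡n j<L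
    ...   | inj₁ 1+j<L = suc j , 1+j<L , cong f eq
    ...   | inj₂ 1+j≡L = 0 , period>0 , cong f eq ∙ cong (λ z → iterate f z x) 1+j≡L ∙ returns

    no-early-repeat : ∀ {i j} → i < j → j < period → iterate f i x ≢ iterate f j x
    no-early-repeat {i} {j} i<j j<L eq = minimal (j ∸ i) (m<n⇒0<n∸m i<j) (≤-<-trans (m∸n≤m j i) j<L)
      (sym (iterate-injective f-inj i (eq ∙ cong (λ z → iterate f z x) (sym (m∸n+n≡m (<⇒≤ i<j)) ∙ +-comm (j ∸ i) i)
        ∙ iterate-+ f i (j ∸ i) x)))

    iterate-distinct : ∀ i j → i < period → j < period → iterate f i x ≡ iterate f j x → i ≡ j
    iterate-distinct i j i<L j<L eq with <-cmp i j
    ... | tri< i<j _ _ = contradiction eq (no-early-repeat i<j j<L)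
    ... | tri≈ _ i≡j _ = i≡j
    ... | tri> _ _ j<i = contradiction (sym eq) (no-early-repeat j<i i<L)

    iterate-back : ∀ k → Σ ℕ λ j → iterate f j (iterate f k x) ≡ x
    iterate-back k with iterate-reduce k
    ... | j , j<L , eq = period ∸ j , cong (iterate f (period ∸ j)) eq ∙ sym (iterate-+ f (period ∸ j) j x)
      ∙ cong (λ z → iterate f z x) (m∸n+n≡m (<⇒≤ j<L)) ∙ returns

  preimage : ∀ z → Σ (Fin m) λ w → f w ≡ z
  preimage z = iterate f (period ∸ 1) z , cong (λ k → iterate f k z) (+-comm 1 (period ∸ 1) ∙ m∸n+n≡m period>0) ∙ returns
    where open Orbit (orbit z)

  ∑-reindex : ∀ (h : Fin m → ℕ) → ∑[ i < m ] h (f i) ≡ ∑[ z < m ] h z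
  ∑-reindex h = sym (∑-permute h (permutation f (λ z → proj₁ (preimage z)) (λ z → proj₂ (preimage z))
    (λ x → f-inj (proj₂ (preimage (f x))))))

IsCycleMin : ∀ {m} → (Fin m → Fin m) → Fin m → Set
IsCycleMin f y = ∀ k → toℕ y ≤ toℕ (iterate f k y)

isCycleMinᵇ : ∀ {m} → (Fin m → Fin m) → Fin m → Bool
isCycleMinᵇ {m} f y = foldr (λ k b → not (toℕ (iterate f (suc k) y) <ᵇ toℕ y) ∧ b) true (upTo m)

isCycleMinᵇ-cong : ∀ {m} {f g : Fin m → Fin m} → f ≗ g → ∀ y → isCycleMinᵇ f y ≡ isCycleMinᵇ g y
isCycleMinᵇ-cong {m} f≗g y =
  foldr-cong (λ k b → cong (λ z → not (toℕ z <ᵇ toℕ y) ∧ b) (iterate-cong f≗g (suc k) y)) refl (upTo m)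

isCycleMinᵇ-complete : ∀ {m} {f : Fin m → Fin m} y → IsCycleMin f y → isCycleMinᵇ f y ≡ true
isCycleMinᵇ-complete {m} {f} y y-min =
  foldr-∧-true⇐ (λ k → not (toℕ (iterate f (suc k) y) <ᵇ toℕ y)) (upTo m) (λ {k} _ → cong not (≥⇒<ᵇ-false (y-min (suc k))))

module _ {m} {f : Fin m → Fin m} (f-inj : Injective _≡_ _≡_ f) where

  isCycleMinᵇ-sound : ∀ y → isCycleMinᵇ f y ≡ true → IsCycleMin f y
  isCycleMinᵇ-sound y is-min k with iterate-reduce f-inj y k
  ... | zero , _ , eq = ≤-reflexive (cong toℕ (sym eq))
  ... | suc j , j<L , eq = subst (λ z → toℕ y ≤ toℕ z) (sym eq) (<ᵇ-false⇒≥ (not-true (foldr-∧-true⇒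
        (λ k → not (toℕ (iterate f (suc k) y) <ᵇ toℕ y)) is-min (∈-upTo⁺ (<⇒≤ (<-≤-trans j<L (Orbit.period≤m (orbit f-inj y))))))))
    where
    not-true : ∀ {b} → not b ≡ true → b ≡ false
    not-true {false} _ = refl

  isCycleMinᵇ-false : ∀ y → ¬ IsCycleMin f y → isCycleMinᵇ f y ≡ false
  isCycleMinᵇ-false y not-min with isCycleMinᵇ f y in eq
  ... | true = contradiction (isCycleMinᵇ-sound y eq) not-min
  ... | false = refl

  cycleMin-unique : ∀ y k → IsCycleMin f y → IsCycleMin f (iterate f k y) → iterate f k y ≡ y
  cycleMin-unique y k y-min z-min with iterate-back f-inj y k
  ... | j , eq = toℕ-injective (≤-antisym (subst (λ w → toℕ (iterate f k y) ≤ toℕ w) eq (z-min j)) (y-min k))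

excᵇ : ∀ {m} → (Fin m → Fin m) → Fin m → Bool
excᵇ f i = toℕ i <ᵇ toℕ (f i)

ascent? : ∀ {m} (f : Fin m → Fin m) z → Dec (Σ (Fin m) λ w → f w ≡ z × toℕ w < toℕ z)
ascent? f z = any? λ w → (f w ≟ᶠ z) ×-dec (toℕ w <? toℕ z)

ascentᵇ : ∀ {m} → (Fin m → Fin m) → Fin m → Bool
ascentᵇ f z = does (ascent? f z)

-- Cycle peaks read off the map: the predecessor and the successor of z are smaller, and the successor
-- is not the minimum of the cycle (which stands for the +∞ closing the cycle word).
peakᵇ : ∀ {m} → (Fin m → Fin m) → Fin m → Bool
peakᵇ f z = ascentᵇ f z ∧ ((toℕ (f z) <ᵇ toℕ z) ∧ not (isCycleMinᵇ f (f z)))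

excCount cycCount peakCount : ∀ {m} → (Fin m → Fin m) → ℕ
excCount {m} f = ∑[ i < m ] 𝟙 (excᵇ f i)
cycCount {m} f = ∑[ y < m ] 𝟙 (isCycleMinᵇ f y)
peakCount {m} f = ∑[ z < m ] 𝟙 (peakᵇ f z)

ascentᵇ-true⇒ : ∀ {m} (f : Fin m → Fin m) z → ascentᵇ f z ≡ true → Σ (Fin m) λ w → f w ≡ z × toℕ w < toℕ z
ascentᵇ-true⇒ f z asc = does-true⇒ (ascent? f z) asc

ascentᵇ-true⇐ : ∀ {m} (f : Fin m → Fin m) {z} w → f w ≡ z → toℕ w < toℕ z → ascentᵇ f z ≡ true
ascentᵇ-true⇐ f {z} w fw≡z w<z = dec-true (ascent? f z) (w , fw≡z , w<z)

ascentᵇ-cong : ∀ {m} {f g : Fin m → Fin m} → f ≗ g → ∀ z → ascentᵇ f z ≡ ascentᵇ g z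
ascentᵇ-cong {f = f} {g} f≗g z = does-⇔
  (mk⇔ (λ (w , fw≡z , w<z) → w , sym (f≗g w) ∙ fw≡z , w<z) (λ (w , gw≡z , w<z) → w , f≗g w ∙ gw≡z , w<z))
  (ascent? f z) (ascent? g z)

ascentᵇ-image : ∀ {m} {f : Fin m → Fin m} → Injective _≡_ _≡_ f → ∀ a → ascentᵇ f (f a) ≡ excᵇ f a
ascentᵇ-image {f = f} f-inj a with excᵇ f a in exc-a
... | true = ascentᵇ-true⇐ f a refl (<ᵇ-true⇒< exc-a)
... | false with ascentᵇ f (f a) in asc
... | false = refl
... | true with ascentᵇ-true⇒ f (f a) asc
... | w , fw≡fa , w<fa with f-inj fw≡fa
... | refl = contradiction w<fa (≤⇒≯ (<ᵇ-false⇒≥ exc-a))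

peakᵇ-cong : ∀ {m} {f g : Fin m → Fin m} → f ≗ g → ∀ z → peakᵇ f z ≡ peakᵇ g z
peakᵇ-cong {f = f} {g} f≗g z = cong₂ _∧_ (ascentᵇ-cong f≗g z)
  (cong₂ (λ a b → (toℕ a <ᵇ toℕ z) ∧ not b) (f≗g z) (isCycleMinᵇ-cong f≗g (f z) ∙ cong (isCycleMinᵇ g) (f≗g z)))

excCount-cong : ∀ {m} {f g : Fin m → Fin m} → f ≗ g → excCount f ≡ excCount g
excCount-cong {m} f≗g = sum-cong-≗ {m} (λ i → cong (λ z → 𝟙 (toℕ i <ᵇ toℕ z)) (f≗g i))

cycCount-cong : ∀ {m} {f g : Fin m → Fin m} → f ≗ g → cycCount f ≡ cycCount g
cycCount-cong {m} f≗g = sum-cong-≗ {m} (λ y → cong 𝟙 (isCycleMinᵇ-cong f≗g y))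

peakCount-cong : ∀ {m} {f g : Fin m → Fin m} → f ≗ g → peakCount f ≡ peakCount g
peakCount-cong {m} f≗g = sum-cong-≗ {m} (λ z → cong 𝟙 (peakᵇ-cong f≗g z))

module _ {m} {f : Fin m → Fin m} (f-inj : Injective _≡_ _≡_ f) where

  cycleLength : Fin m → ℕ
  cycleLength y = Orbit.period (orbit f-inj y)

  reaches? : ∀ y z → Dec (Σ ℕ λ k → k < m × iterate f k y ≡ z)
  reaches? y z = anyUpTo? (λ k → iterate f k y ≟ᶠ z) m

  reaches-iterate : ∀ y k → does (reaches? y (iterate f k y)) ≡ true
  reaches-iterate y k with iterate-reduce f-inj y k
  ... | j , j<L , eq = dec-true (reaches? y _) (j , <-≤-trans j<L (Orbit.period≤m (orbit f-inj y)) , sym eq)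

  orbit-sum : ∀ y (h : Fin m → ℕ) → sumBelow (cycleLength y) (λ k → h (iterate f k y)) ≡ ∑[ z < m ] (𝟙 (does (reaches? y z)) * h z)
  orbit-sum y h = sym (sum-applyUpTo (λ k → iterate f k y) h (cycleLength y))
    ∙ sum-map-unique (applyUpTo⁺₁ _ (cycleLength y) (no-early-repeat f-inj y)) (filter⁺ (reaches? y) (allFin⁺ m))
        orbit⊆reached reached⊆orbit h
    ∙ sum-filter (reaches? y) (allFin m) h ∙ sum-allFin m _
    where
    orbit⊆reached : ∀ {z} → z ∈ applyUpTo (λ k → iterate f k y) (cycleLength y) → z ∈ filter (reaches? y) (allFin m)
    orbit⊆reached z∈ with ∈-applyUpTo⁻ (λ k → iterate f k y) z∈
    ... | k , _ , refl = ∈-filter⁺ (reaches? y) (∈-allFin _) (does-true⇒ (reaches? y _) (reaches-iterate y k))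
    reached⊆orbit : ∀ {z} → z ∈ filter (reaches? y) (allFin m) → z ∈ applyUpTo (λ k → iterate f k y) (cycleLength y)
    reached⊆orbit z∈ with proj₂ (∈-filter⁻ (reaches? y) {xs = allFin m} z∈)
    ... | k , _ , refl with iterate-reduce f-inj y k
    ... | j , j<L , eq = subst (_∈ applyUpTo (λ k → iterate f k y) (cycleLength y)) (sym eq) (∈-applyUpTo⁺ (λ k → iterate f k y) j<L)

  -- The cycle minimum reaching z is the least element of the orbit of z.
  unique-cycleMin-reaching : ∀ z → ∑[ y < m ] (𝟙 (isCycleMinᵇ f y) * 𝟙 (does (reaches? y z))) ≡ 1
  unique-cycleMin-reaching z = ∑-single _ y₀ others
    ∙ cong₂ (λ a b → 𝟙 a * 𝟙 b) (isCycleMinᵇ-complete y₀ y₀-min) y₀-reaches-z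
    where
    height : ℕ → ℕ
    height k = toℕ (iterate f k z)
    i₀ : ℕ
    i₀ = argmin height 0 (upTo m)
    y₀ : Fin m
    y₀ = iterate f i₀ z
    y₀-min : IsCycleMin f y₀
    y₀-min k with iterate-reduce f-inj z (k + i₀)
    ... | j , j<L , eq = subst (λ w → toℕ y₀ ≤ toℕ w) (sym eq ∙ iterate-+ f k i₀ z)
      (All.lookup (f[argmin]≤f[xs] {f = height} 0 (upTo m)) (∈-upTo⁺ (<-≤-trans j<L (Orbit.period≤m (orbit f-inj z)))))
    y₀-reaches-z : does (reaches? y₀ z) ≡ true
    y₀-reaches-z with iterate-back f-inj z i₀
    ... | j , eq = subst (λ w → does (reaches? y₀ w) ≡ true) eq (reaches-iterate y₀ j)
    others : ∀ y → y ≢ y₀ → 𝟙 (isCycleMinᵇ f y) * 𝟙 (does (reaches? y z)) ≡ 0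
    others y y≢y₀ with isCycleMinᵇ f y in y-min | reaches? y z
    ... | false | _ = refl
    ... | true | no _ = refl
    ... | true | yes (k , _ , refl) = contradiction (sym (cycleMin-unique f-inj y (i₀ + k) (isCycleMinᵇ-sound f-inj y y-min)
            (subst (IsCycleMin f) (sym (iterate-+ f i₀ k y)) y₀-min)) ∙ iterate-+ f i₀ k y) y≢y₀

  sum-over-cycles : ∀ (h : Fin m → ℕ) →
    ∑[ y < m ] (𝟙 (isCycleMinᵇ f y) * sumBelow (cycleLength y) (λ k → h (iterate f k y))) ≡ ∑[ z < m ] h z
  sum-over-cycles h = begin
    ∑[ y < m ] (𝟙 (isCycleMinᵇ f y) * sumBelow (cycleLength y) (λ k → h (iterate f k y)))
      ≡⟨ sum-cong-≗ {m} (λ y → cong (𝟙 (isCycleMinᵇ f y) *_) (orbit-sum y h) ∙ sym (∑-*ˡ (𝟙 (isCycleMinᵇ f y)) (λ z → R y z * h z))) ⟩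
    ∑[ y < m ] ∑[ z < m ] (𝟙 (isCycleMinᵇ f y) * (R y z * h z))
      ≡⟨ ∑-comm {m} {m} (λ y z → 𝟙 (isCycleMinᵇ f y) * (R y z * h z)) ⟩
    ∑[ z < m ] ∑[ y < m ] (𝟙 (isCycleMinᵇ f y) * (R y z * h z))
      ≡⟨ sum-cong-≗ {m} (λ z → sum-cong-≗ {m} (λ y → solve 3 (λ a b c → a :* (b :* c) := c :* (a :* b)) refl (𝟙 (isCycleMinᵇ f y)) (R y z) (h z))
           ∙ ∑-*ˡ (h z) (λ y → 𝟙 (isCycleMinᵇ f y) * R y z) ∙ cong (h z *_) (unique-cycleMin-reaching z) ∙ *-identityʳ (h z)) ⟩
    ∑[ z < m ] h z ∎
    where
    R : Fin m → Fin m → ℕ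
    R y z = 𝟙 (does (reaches? y z))

<ᵇ-flip : ∀ y z → y ≢ z → (z <ᵇ y) ≡ not (y <ᵇ z)
<ᵇ-flip y z y≢z with y <ᵇ z in y<z
... | true = ≥⇒<ᵇ-false {z} {y} (<⇒≤ (<ᵇ-true⇒< y<z))
... | false = <⇒<ᵇ-true (≤∧≢⇒< (<ᵇ-false⇒≥ y<z) (λ z≡y → y≢z (sym z≡y)))

-- Reading the word left to right, each peak turns the direction down and, since the word ends
-- with +∞, it is turned up again later: two new runs per peak, plus one for an initial descent.
altRunsFrom-peaksFrom : ∀ x y ys → Linked _≢_ (y ∷ ys) →
  altRunsFrom (x <ᵇ y) (fin y) (extWord ys) ≡ 2 * peaksFrom (fin x) (fin y) (extWord ys) + 𝟙 (not (x <ᵇ y))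
altRunsFrom-peaksFrom x y [] _ with x <ᵇ y
... | true = refl
... | false = refl
altRunsFrom-peaksFrom x y (z ∷ ys) (y≢z ∷ linked)
  rewrite altRunsFrom-peaksFrom y z ys linked | <ᵇ-flip y z y≢z = step (x <ᵇ y) (y <ᵇ z) (peaksFrom (fin y) (fin z) (extWord ys))
  where
  step : ∀ up up′ P → (if ⌊ up′ Bool.≟ up ⌋ then 0 else 1) + (2 * P + 𝟙 (not up′))
                    ≡ 2 * ((if up ∧ not up′ then 1 else 0) + P) + 𝟙 (not up)
  step true true P = +-identityʳ (2 * P) ∙ sym (+-identityʳ (2 * P))
  step true false P = solve 1 (λ P → con 1 :+ (con 2 :* P :+ con 1) := con 2 :* (con 1 :+ P) :+ con 0) refl P
  step false true P = solve 1 (λ P → con 1 :+ (con 2 :* P :+ con 0) := con 2 :* (con 0 :+ P) :+ con 1) refl P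
  step false false P = refl

crunWord≡1+2*cpkWord : ∀ x y ys → x < y → Linked _≢_ (y ∷ ys) → crunWord (x ∷ y ∷ ys) ≡ 1 + 2 * cpkWord (x ∷ y ∷ ys)
crunWord≡1+2*cpkWord x y ys x<y linked = cong suc (altRunsFrom-peaksFrom x y ys linked
  ∙ cong (λ b → 2 * peaksFrom (fin x) (fin y) (extWord ys) + 𝟙 (not b)) (<⇒<ᵇ-true x<y) ∙ +-identityʳ _)

segment : ∀ {A : Set} → (ℕ → A) → ℕ → ℕ → List A
segment w j zero = []
segment w j (suc d) = w j ∷ segment w (suc j) d

segment-linked : ∀ (w : ℕ → ℕ) j d → (∀ k → j ≤ k → suc k < j + d → w k ≢ w (suc k)) → Linked _≢_ (segment w j d)
segment-linked w j zero _ = []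
segment-linked w j (suc zero) _ = [-]
segment-linked w j (suc (suc d)) distinct =
  distinct j ≤-refl (subst (suc j <_) (sym (+-suc j (suc d) ∙ cong suc (+-suc j d))) (s≤s (s≤s (m≤m+n j d))))
  ∷ segment-linked w (suc j) (suc d) (λ k j<k 1+k< → distinct k (<⇒≤ j<k) (subst (suc k <_) (sym (+-suc j (suc d))) 1+k<))

peakAfter : (ℕ → ℕ) → ℕ → Bool
peakAfter w t = (w t <ᵇ w (suc t)) ∧ (w (suc (suc t)) <ᵇ w (suc t))

peaksFrom-segment : ∀ (w : ℕ → ℕ) i d →
  peaksFrom (fin (w i)) (fin (w (suc i))) (extWord (segment w (suc (suc i)) d)) ≡ sumBelow d (λ t → 𝟙 (peakAfter w (i + t)))
peaksFrom-segment w i zero with w i <ᵇ w (suc i)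
... | true = refl
... | false = refl
peaksFrom-segment w i (suc d) = cong₂ _+_ (if-𝟙 (peakAfter w i) ∙ cong (λ k → 𝟙 (peakAfter w k)) (sym (+-identityʳ i)))
  (peaksFrom-segment w (suc i) d ∙ sumBelow-cong d (λ t _ → cong (λ k → 𝟙 (peakAfter w k)) (sym (+-suc i t))))
  where
  if-𝟙 : ∀ b → (if b then 1 else 0) ≡ 𝟙 b
  if-𝟙 true = refl
  if-𝟙 false = refl

-- The walk along the cycle inside `cycleWord` is a local helper that is not in scope here.
-- `cycleWordHelper` is a metavariable that unification with an unfolding of `cycleWord` (at a
-- fresh size n and a fresh point z, so that the problem is a pattern) solves to that helper.
mutual
  cycleWordHelper : (n : ℕ) → Perm n → Fin n → ℕ → Fin n → List ℕ
  cycleWordHelper = _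

  private
    unfold-cycleWord : ∀ k (π : Perm (suc k)) y → cycleWord π y ≡
      toℕ y ∷ (if ⌊ lookup π y ≟ᶠ y ⌋ then [] else toℕ (lookup π y) ∷ cycleWordHelper (suc k) π y k (lookup π (lookup π y)))
    unfold-cycleWord k with suc k
    ... | n = generalised n k

    generalised : (n k : ℕ) (π : Perm n) (y : Fin n) → _
    generalised n k π y with lookup π (lookup π y)
    ... | z = refl

walk : ∀ {n} → Perm n → Fin n → ℕ → Fin n → List ℕ
walk π y zero z = []
walk π y (suc fuel) z = if ⌊ z ≟ᶠ y ⌋ then [] else toℕ z ∷ walk π y fuel (lookup π z)

cycleWordHelper≡walk : ∀ n (π : Perm n) y fuel z → cycleWordHelper n π y fuel z ≡ walk π y fuel z
cycleWordHelper≡walk n π y zero z = refl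
cycleWordHelper≡walk n π y (suc fuel) z rewrite cycleWordHelper≡walk n π y fuel (lookup π z) = refl

cycleWord≡walk : ∀ {n} (π : Perm n) y → cycleWord π y ≡ toℕ y ∷ walk π y n (lookup π y)
cycleWord≡walk {n} π y = cong (toℕ y ∷_) (cycleWordHelper≡walk n π y n (lookup π y))

module CycleWord {n} (π : Perm n) (π-inj : Injective _≡_ _≡_ (lookup π)) (y : Fin n) (y-min : isCycleMinᵇ (lookup π) y ≡ true) where
  private
    f = lookup π
  open Orbit (orbit π-inj y)

  point : ℕ → Fin n
  point k = iterate f k y

  height : ℕ → ℕ
  height k = toℕ (point k)

  y-minimal : IsCycleMin f y
  y-minimal = isCycleMinᵇ-sound π-inj y y-min

  walk-segment : ∀ d j fuel → j + d ≡ period → 0 < j → d ≤ fuel → walk π y fuel (point j) ≡ segment height j d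
  walk-segment zero j fuel j≡L _ _ rewrite +-identityʳ j | j≡L | returns = stops fuel
    where
    stops : ∀ fuel → walk π y fuel y ≡ []
    stops zero = refl
    stops (suc fuel) with y ≟ᶠ y
    ... | yes _ = refl
    ... | no y≢y = contradiction refl y≢y
  walk-segment (suc d) j (suc fuel) j+d≡L j>0 (s≤s d≤fuel) with point j ≟ᶠ y
  ... | yes returned = contradiction returned (minimal j j>0 (subst (j <_) j+d≡L (subst (j <_) (sym (+-suc j d)) (s≤s (m≤m+n j d)))))
  ... | no _ = cong (height j ∷_) (walk-segment d (suc j) fuel (sym (+-suc j d) ∙ j+d≡L) (s≤s z≤n) d≤fuel)

  module _ (L′ : ℕ) (period≡ : period ≡ suc L′) where

    cycleWord-segment : cycleWord π y ≡ segment height 0 (suc L′)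
    cycleWord-segment = cycleWord≡walk π y
      ∙ cong (toℕ y ∷_) (walk-segment L′ 1 n (sym period≡) (s≤s z≤n) (<⇒≤ (subst (_≤ n) period≡ period≤m)))

    segment-linked-tail : Linked _≢_ (segment height 1 L′)
    segment-linked-tail = segment-linked height 1 L′ λ k _ 1+k<1+L′ eq →
      1+n≢n (sym (iterate-distinct π-inj y k (suc k) (<-trans (n<1+n k) (bound 1+k<1+L′)) (bound 1+k<1+L′) (toℕ-injective eq)))
      where
      bound : ∀ {k} → k < suc L′ → k < period
      bound {k} = subst (k <_) (sym period≡)

    returns-from-last : f (point L′) ≡ y
    returns-from-last = cong (λ k → iterate f k y) (sym period≡) ∙ returns

    first-not-peak : peakᵇ f y ≡ false
    first-not-peak = cong (_∧ ((toℕ (f y) <ᵇ toℕ y) ∧ not (isCycleMinᵇ f (f y)))) no-ascent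
      where
      no-ascent : ascentᵇ f y ≡ false
      no-ascent = subst (λ z → ascentᵇ f z ≡ false) returns-from-last
        (ascentᵇ-image π-inj (point L′) ∙ cong (λ z → height L′ <ᵇ toℕ z) returns-from-last ∙ ≥⇒<ᵇ-false (y-minimal L′))

    last-not-peak : peakᵇ f (point L′) ≡ false
    last-not-peak rewrite returns-from-last | y-min = cong (ascentᵇ f (point L′) ∧_) (Bool.∧-zeroʳ _) ∙ Bool.∧-zeroʳ _

  inner-peak : ∀ t → suc (suc t) < period → peakᵇ f (point (suc t)) ≡ peakAfter height t
  inner-peak t t+2<L
    rewrite ascentᵇ-image π-inj (point t)
          | isCycleMinᵇ-false π-inj (point (suc (suc t)))
              (λ is-min → minimal (suc (suc t)) (s≤s z≤n) t+2<L (cycleMin-unique π-inj y (suc (suc t)) y-minimal is-min))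
    = cong ((height t <ᵇ height (suc t)) ∧_) (Bool.∧-identityʳ _)

  lastIndex : ℕ
  lastIndex = period ∸ 1

  period≡1+lastIndex : period ≡ suc lastIndex
  period≡1+lastIndex = sym (+-comm 1 lastIndex ∙ m∸n+n≡m period>0)

  crunWord-cycle : crunWord (cycleWord π y) ≡ 1 + 2 * cpkWord (cycleWord π y)
  crunWord-cycle = subst (λ w → crunWord w ≡ 1 + 2 * cpkWord w) (sym (cycleWord-segment lastIndex period≡1+lastIndex)) (by-length lastIndex period≡1+lastIndex)
    where
    by-length : ∀ L′ → period ≡ suc L′ → crunWord (segment height 0 (suc L′)) ≡ 1 + 2 * cpkWord (segment height 0 (suc L′))
    by-length zero _ = refl
    by-length (suc d) period≡ = crunWord≡1+2*cpkWord (height 0) (height 1) (segment height 2 d) first-ascent (segment-linked-tail (suc d) period≡)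
      where
      first-ascent : height 0 < height 1
      first-ascent = ≤∧≢⇒< (y-minimal 1) λ eq →
        0≢1+n (iterate-distinct π-inj y 0 1 period>0 (subst (1 <_) (sym period≡) (s≤s (s≤s z≤n))) (toℕ-injective eq))

  cpkWord-cycle : cpkWord (cycleWord π y) ≡ sumBelow period (λ k → 𝟙 (peakᵇ f (point k)))
  cpkWord-cycle = cong cpkWord (cycleWord-segment lastIndex period≡1+lastIndex) ∙ by-length lastIndex period≡1+lastIndex
    ∙ cong (λ L → sumBelow L (λ k → 𝟙 (peakᵇ f (point k)))) (sym period≡1+lastIndex)
    where
    by-length : ∀ L′ → period ≡ suc L′ → cpkWord (segment height 0 (suc L′)) ≡ sumBelow (suc L′) (λ k → 𝟙 (peakᵇ f (point k)))
    by-length zero period≡ = cong (λ b → 𝟙 b + 0) (sym (first-not-peak zero period≡))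
    by-length (suc d) period≡ = peaksFrom-segment height 0 d ∙ sym (begin
      𝟙 (peakᵇ f y) + sumBelow (suc d) (λ k → 𝟙 (peakᵇ f (point (suc k))))
        ≡⟨ cong₂ _+_ (cong 𝟙 (first-not-peak (suc d) period≡)) (sumBelow-last d (λ k → 𝟙 (peakᵇ f (point (suc k))))) ⟩
      sumBelow d (λ k → 𝟙 (peakᵇ f (point (suc k)))) + 𝟙 (peakᵇ f (point (suc d)))
        ≡⟨ cong (sumBelow d (λ k → 𝟙 (peakᵇ f (point (suc k)))) +_) (cong 𝟙 (last-not-peak (suc d) period≡)) ∙ +-identityʳ _ ⟩
      sumBelow d (λ k → 𝟙 (peakᵇ f (point (suc k))))
        ≡⟨ sumBelow-cong d (λ t t<d → cong 𝟙 (inner-peak t (subst (suc (suc t) <_) (sym period≡) (s≤s (s≤s t<d))))) ⟩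
      sumBelow d (λ t → 𝟙 (peakAfter height t)) ∎)

module _ {n} (π : Perm n) where

  iter≡iterate : ∀ k x → iter π k x ≡ iterate (lookup π) k x
  iter≡iterate zero x = refl
  iter≡iterate (suc k) x = cong (lookup π) (iter≡iterate k x)

  isCycleMin≡isCycleMinᵇ : ∀ y → isCycleMin π y ≡ isCycleMinᵇ (lookup π) y
  isCycleMin≡isCycleMinᵇ y = foldr-cong (λ k b → cong (λ z → not (toℕ z <ᵇ toℕ y) ∧ b) (iter≡iterate (suc k) y)) refl (upTo n)

  exc≡excCount : exc π ≡ excCount (lookup π)
  exc≡excCount = count≡sum-𝟙 _ (allFin n) ∙ sum-allFin n _

  cyc≡cycCount : cyc π ≡ cycCount (lookup π)
  cyc≡cycCount = count≡sum-𝟙 (isCycleMin π) (allFin n) ∙ sum-allFin n _ ∙ sum-cong-≗ {n} (λ y → cong 𝟙 (isCycleMin≡isCycleMinᵇ y))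

  sum-cycleMins : ∀ (h : Fin n → ℕ) → sum (map h (cycleMins π)) ≡ ∑[ y < n ] (𝟙 (isCycleMinᵇ (lookup π) y) * h y)
  sum-cycleMins h = sum-filter (λ y → isCycleMin π y Bool.≟ true) (allFin n) h ∙ sum-allFin n _
    ∙ sum-cong-≗ {n} (λ y → cong (λ b → 𝟙 b * h y) (does-≟-true (isCycleMin π y) ∙ isCycleMin≡isCycleMinᵇ y))

  module _ (π-inj : Injective _≡_ _≡_ (lookup π)) where

    cpk≡peakCount : cpk π ≡ peakCount (lookup π)
    cpk≡peakCount = sum-cycleMins (λ y → cpkWord (cycleWord π y)) ∙ sum-cong-≗ {n} on-cycle
      ∙ sum-over-cycles π-inj (λ z → 𝟙 (peakᵇ (lookup π) z))
      where
      on-cycle : ∀ y → 𝟙 (isCycleMinᵇ (lookup π) y) * cpkWord (cycleWord π y)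
                     ≡ 𝟙 (isCycleMinᵇ (lookup π) y) * sumBelow (cycleLength π-inj y) (λ k → 𝟙 (peakᵇ (lookup π) (iterate (lookup π) k y)))
      on-cycle y with isCycleMinᵇ (lookup π) y in y-min
      ... | true = cong (1 *_) (CycleWord.cpkWord-cycle π π-inj y y-min)
      ... | false = refl

    crun≡cycCount+2*peakCount : crun π ≡ cycCount (lookup π) + 2 * peakCount (lookup π)
    crun≡cycCount+2*peakCount = sum-cycleMins (λ y → crunWord (cycleWord π y)) ∙ sum-cong-≗ {n} on-cycle
      ∙ ∑-distrib-+ {n} (λ y → 𝟙 (isCycleMinᵇ (lookup π) y) * 1) (λ y → 2 * (𝟙 (isCycleMinᵇ (lookup π) y) * cpkWord (cycleWord π y)))
      ∙ cong₂ _+_ (sum-cong-≗ {n} (λ y → *-identityʳ _))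
                  (∑-*ˡ 2 (λ y → 𝟙 (isCycleMinᵇ (lookup π) y) * cpkWord (cycleWord π y))
                   ∙ cong (2 *_) (sym (sum-cycleMins (λ y → cpkWord (cycleWord π y))) ∙ cpk≡peakCount))
      where
      on-cycle : ∀ y → 𝟙 (isCycleMinᵇ (lookup π) y) * crunWord (cycleWord π y)
                     ≡ 𝟙 (isCycleMinᵇ (lookup π) y) * 1 + 2 * (𝟙 (isCycleMinᵇ (lookup π) y) * cpkWord (cycleWord π y))
      on-cycle y with isCycleMinᵇ (lookup π) y in y-min
      ... | true = cong (1 *_) (CycleWord.crunWord-cycle π π-inj y y-min)
                   ∙ solve 1 (λ c → con 1 :* (con 1 :+ con 2 :* c) := con 1 :* con 1 :+ con 2 :* (con 1 :* c)) refl (cpkWord (cycleWord π y))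
      ... | false = refl

inject₁<fromℕ : ∀ {n} (i : Fin n) → toℕ (inject₁ i) < toℕ (fromℕ n)
inject₁<fromℕ {n} i rewrite toℕ-inject₁ i | toℕ-fromℕ n = toℕ<n i

isCycleMinᵇ-≡ : ∀ {m m′} {f : Fin m → Fin m} {g : Fin m′ → Fin m′} → Injective _≡_ _≡_ f → Injective _≡_ _≡_ g →
  ∀ {x y} → (IsCycleMin f x → IsCycleMin g y) → (IsCycleMin g y → IsCycleMin f x) → isCycleMinᵇ f x ≡ isCycleMinᵇ g y
isCycleMinᵇ-≡ {f = f} {g} f-inj g-inj {x} {y} to from with isCycleMinᵇ f x in x-min
... | true = sym (isCycleMinᵇ-complete y (to (isCycleMinᵇ-sound f-inj x x-min)))
... | false = sym (isCycleMinᵇ-false g-inj y λ y-min → case sym x-min ∙ isCycleMinᵇ-complete x (from y-min) of λ ())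

peakᵇ-≡ : ∀ {m m′} (f : Fin m → Fin m) (g : Fin m′ → Fin m′) z z′ → ascentᵇ f z ≡ ascentᵇ g z′ →
  toℕ (f z) ≡ toℕ (g z′) → toℕ z ≡ toℕ z′ → isCycleMinᵇ f (f z) ≡ isCycleMinᵇ g (g z′) → peakᵇ f z ≡ peakᵇ g z′
peakᵇ-≡ f g z z′ asc fz z≡ cm = cong₂ _∧_ asc (cong₂ _∧_ (cong₂ _<ᵇ_ fz z≡) (cong not cm))

peakᵇ-no-descent : ∀ {m} (f : Fin m → Fin m) z → (toℕ (f z) <ᵇ toℕ z) ≡ false → peakᵇ f z ≡ false
peakᵇ-no-descent f z no-descent rewrite no-descent = Bool.∧-zeroʳ (ascentᵇ f z)

module AddFixedPoint {n} (f : Fin n → Fin n) where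

  g : Fin (suc n) → Fin (suc n)
  g j with view j
  ... | ‵fromℕ = fromℕ n
  ... | ‵inject₁ i = inject₁ (f i)

  g-top : g (fromℕ n) ≡ fromℕ n
  g-top rewrite view-fromℕ n = refl

  g-inject₁ : ∀ i → g (inject₁ i) ≡ inject₁ (f i)
  g-inject₁ i rewrite view-inject₁ i = refl

  module _ (f-inj : Injective _≡_ _≡_ f) where

    g-inj : Injective _≡_ _≡_ g
    g-inj {i} {j} eq with view i | view j
    ... | ‵fromℕ | ‵fromℕ = refl
    ... | ‵fromℕ | ‵inject₁ j′ = contradiction eq fromℕ≢inject₁
    ... | ‵inject₁ i′ | ‵fromℕ = contradiction (sym eq) fromℕ≢inject₁
    ... | ‵inject₁ i′ | ‵inject₁ j′ = cong inject₁ (f-inj (inject₁-injective eq))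

    iterate-inject₁ : ∀ k y → iterate g k (inject₁ y) ≡ inject₁ (iterate f k y)
    iterate-inject₁ zero y = refl
    iterate-inject₁ (suc k) y = cong g (iterate-inject₁ k y) ∙ g-inject₁ _

    iterate-top : ∀ k → iterate g k (fromℕ n) ≡ fromℕ n
    iterate-top zero = refl
    iterate-top (suc k) = cong g (iterate-top k) ∙ g-top

    heights : ∀ k y → toℕ (iterate g k (inject₁ y)) ≡ toℕ (iterate f k y)
    heights k y = cong toℕ (iterate-inject₁ k y) ∙ toℕ-inject₁ _

    isCycleMin-inject₁ : ∀ y → isCycleMinᵇ g (inject₁ y) ≡ isCycleMinᵇ f y
    isCycleMin-inject₁ y = isCycleMinᵇ-≡ g-inj f-inj
      (λ y-min k → subst₂ _≤_ (toℕ-inject₁ y) (heights k y) (y-min k))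
      (λ y-min k → subst₂ _≤_ (sym (toℕ-inject₁ y)) (sym (heights k y)) (y-min k))

    isCycleMin-top : isCycleMinᵇ g (fromℕ n) ≡ true
    isCycleMin-top = isCycleMinᵇ-complete _ (λ k → ≤-reflexive (cong toℕ (sym (iterate-top k))))

    ascent-inject₁ : ∀ z → ascentᵇ g (inject₁ z) ≡ ascentᵇ f z
    ascent-inject₁ z = does-⇔ (mk⇔ to from) (ascent? g (inject₁ z)) (ascent? f z)
      where
      to : (Σ _ λ w → g w ≡ inject₁ z × toℕ w < toℕ (inject₁ z)) → Σ _ λ w → f w ≡ z × toℕ w < toℕ z
      to (w , gw≡z , w<z) with view w
      ... | ‵fromℕ = contradiction gw≡z fromℕ≢inject₁
      ... | ‵inject₁ w′ = w′ , inject₁-injective gw≡z , subst₂ _<_ (toℕ-inject₁ w′) (toℕ-inject₁ z) w<z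
      from : (Σ _ λ w → f w ≡ z × toℕ w < toℕ z) → Σ _ λ w → g w ≡ inject₁ z × toℕ w < toℕ (inject₁ z)
      from (w , fw≡z , w<z) = inject₁ w , g-inject₁ w ∙ cong inject₁ fw≡z , subst₂ _<_ (sym (toℕ-inject₁ w)) (sym (toℕ-inject₁ z)) w<z

    excCount≡ : excCount g ≡ excCount f
    excCount≡ = sum-init-last {n} (λ j → 𝟙 (excᵇ g j))
      ∙ cong₂ _+_ (sum-cong-≗ {n} (λ i → cong 𝟙 (cong₂ _<ᵇ_ (toℕ-inject₁ i) (cong toℕ (g-inject₁ i) ∙ toℕ-inject₁ (f i)))))
                  (cong (λ z → 𝟙 (toℕ (fromℕ n) <ᵇ toℕ z)) g-top ∙ cong 𝟙 (≥⇒<ᵇ-false {toℕ (fromℕ n)} ≤-refl))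
      ∙ +-identityʳ _

    cycCount≡ : cycCount g ≡ cycCount f + 1
    cycCount≡ = sum-init-last {n} (λ j → 𝟙 (isCycleMinᵇ g j))
      ∙ cong₂ _+_ (sum-cong-≗ {n} (λ i → cong 𝟙 (isCycleMin-inject₁ i))) (cong 𝟙 isCycleMin-top)

    peakCount≡ : peakCount g ≡ peakCount f
    peakCount≡ = sum-init-last {n} (λ j → 𝟙 (peakᵇ g j))
      ∙ cong₂ _+_ (sum-cong-≗ {n} (λ i → cong 𝟙 (peakᵇ-≡ g f (inject₁ i) i (ascent-inject₁ i) (cong toℕ (g-inject₁ i) ∙ toℕ-inject₁ (f i))
                      (toℕ-inject₁ i) (cong (isCycleMinᵇ g) (g-inject₁ i) ∙ isCycleMin-inject₁ (f i)))))
                  (cong 𝟙 (peakᵇ-no-descent g (fromℕ n) (cong (λ z → toℕ z <ᵇ toℕ (fromℕ n)) g-top ∙ ≥⇒<ᵇ-false {toℕ (fromℕ n)} ≤-refl)))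
      ∙ +-identityʳ _

module InsertAfter {n} (f : Fin n → Fin n) (a : Fin n) where

  g : Fin (suc n) → Fin (suc n)
  g j with view j
  ... | ‵fromℕ = inject₁ (f a)
  ... | ‵inject₁ i = if does (i ≟ᶠ a) then fromℕ n else inject₁ (f i)

  g-top : g (fromℕ n) ≡ inject₁ (f a)
  g-top rewrite view-fromℕ n = refl

  g-at : g (inject₁ a) ≡ fromℕ n
  g-at rewrite view-inject₁ a | dec-true (a ≟ᶠ a) refl = refl

  g-inject₁ : ∀ i → i ≢ a → g (inject₁ i) ≡ inject₁ (f i)
  g-inject₁ i i≢a rewrite view-inject₁ i | dec-false (i ≟ᶠ a) i≢a = refl

  data Case : Fin (suc n) → Set where
    top : Case (fromℕ n)
    at : Case (inject₁ a)
    other : ∀ i → i ≢ a → Case (inject₁ i)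

  case-of : ∀ j → Case j
  case-of j with view j
  ... | ‵fromℕ = top
  ... | ‵inject₁ i with i ≟ᶠ a
  ...   | yes refl = at
  ...   | no i≢a = other i i≢a

  module _ (f-inj : Injective _≡_ _≡_ f) where

    g-inj : Injective _≡_ _≡_ g
    g-inj {i} {j} eq with case-of i | case-of j
    ... | top | top = refl
    ... | top | at = contradiction (sym (sym g-top ∙ eq ∙ g-at)) fromℕ≢inject₁
    ... | top | other j′ j′≢a = contradiction (sym (f-inj (inject₁-injective (sym g-top ∙ eq ∙ g-inject₁ j′ j′≢a)))) j′≢a
    ... | at | top = contradiction (sym g-at ∙ eq ∙ g-top) fromℕ≢inject₁
    ... | at | at = refl
    ... | at | other j′ j′≢a = contradiction (sym g-at ∙ eq ∙ g-inject₁ j′ j′≢a) fromℕ≢inject₁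
    ... | other i′ i′≢a | top = contradiction (f-inj (inject₁-injective (sym (g-inject₁ i′ i′≢a) ∙ eq ∙ g-top))) i′≢a
    ... | other i′ i′≢a | at = contradiction (sym (sym (g-inject₁ i′ i′≢a) ∙ eq ∙ g-at)) fromℕ≢inject₁
    ... | other i′ i′≢a | other j′ j′≢a = cong inject₁ (f-inj (inject₁-injective (sym (g-inject₁ i′ i′≢a) ∙ eq ∙ g-inject₁ j′ j′≢a)))

    -- The cycles of g are those of f, with n spliced in after a.
    iterate-g-inject₁ : ∀ y k → (Σ ℕ λ j → iterate g k (inject₁ y) ≡ inject₁ (iterate f j y))
                              ⊎ (iterate g k (inject₁ y) ≡ fromℕ n × Σ ℕ λ j → iterate f j y ≡ a)
    iterate-g-inject₁ y zero = inj₁ (0 , refl)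
    iterate-g-inject₁ y (suc k) with iterate-g-inject₁ y k
    ... | inj₂ (at-top , j , reaches-a) = inj₁ (suc j , cong g at-top ∙ g-top ∙ cong (λ z → inject₁ (f z)) (sym reaches-a))
    ... | inj₁ (j , eq) with iterate f j y ≟ᶠ a
    ...   | yes reaches-a = inj₂ (cong g eq ∙ cong (λ z → g (inject₁ z)) reaches-a ∙ g-at , j , reaches-a)
    ...   | no misses-a = inj₁ (suc j , cong g eq ∙ g-inject₁ _ misses-a)

    iterate-f-in-g : ∀ y k → Σ ℕ λ k′ → iterate g k′ (inject₁ y) ≡ inject₁ (iterate f k y)
    iterate-f-in-g y zero = 0 , refl
    iterate-f-in-g y (suc k) with iterate-f-in-g y k | iterate f k y ≟ᶠ a
    ... | k′ , eq | yes reaches-a = suc (suc k′) , cong (λ z → g (g z)) (eq ∙ cong inject₁ reaches-a) ∙ cong g g-at ∙ g-top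
                                     ∙ cong (λ z → inject₁ (f z)) (sym reaches-a)
    ... | k′ , eq | no misses-a = suc k′ , cong g eq ∙ g-inject₁ _ misses-a

    isCycleMin-inject₁ : ∀ y → isCycleMinᵇ g (inject₁ y) ≡ isCycleMinᵇ f y
    isCycleMin-inject₁ y = isCycleMinᵇ-≡ g-inj f-inj to from
      where
      to : IsCycleMin g (inject₁ y) → IsCycleMin f y
      to y-min k with iterate-f-in-g y k
      ... | k′ , eq = subst₂ _≤_ (toℕ-inject₁ y) (cong toℕ eq ∙ toℕ-inject₁ _) (y-min k′)
      from : IsCycleMin f y → IsCycleMin g (inject₁ y)
      from y-min k with iterate-g-inject₁ y k
      ... | inj₁ (j , eq) = subst₂ _≤_ (sym (toℕ-inject₁ y)) (sym (cong toℕ eq ∙ toℕ-inject₁ _)) (y-min j)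
      ... | inj₂ (at-top , _) = subst (λ z → toℕ (inject₁ y) ≤ toℕ z) (sym at-top) (<⇒≤ (inject₁<fromℕ y))

    isCycleMin-top : isCycleMinᵇ g (fromℕ n) ≡ false
    isCycleMin-top = isCycleMinᵇ-false g-inj (fromℕ n)
      (λ top-min → ≤⇒≯ (top-min 1) (subst (λ z → toℕ z < toℕ (fromℕ n)) (sym g-top) (inject₁<fromℕ (f a))))

    cycCount≡ : cycCount g ≡ cycCount f
    cycCount≡ = sum-init-last {n} (λ j → 𝟙 (isCycleMinᵇ g j))
      ∙ cong₂ _+_ (sum-cong-≗ {n} (λ i → cong 𝟙 (isCycleMin-inject₁ i))) (cong 𝟙 isCycleMin-top) ∙ +-identityʳ _

    excCount≡ : excCount g + 𝟙 (excᵇ f a) ≡ excCount f + 1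
    excCount≡ = cong (_+ 𝟙 (excᵇ f a)) (sum-init-last {n} (λ j → 𝟙 (excᵇ g j)) ∙ cong (∑[ i < n ] 𝟙 (excᵇ g (inject₁ i)) +_) (cong 𝟙 exc-top) ∙ +-identityʳ _)
      ∙ ∑-update (λ i → 𝟙 (excᵇ g (inject₁ i))) (λ i → 𝟙 (excᵇ f i)) a (λ i i≢a → cong 𝟙 (exc-other i i≢a))
      ∙ cong (λ b → excCount f + 𝟙 b) exc-at
      where
      exc-top : excᵇ g (fromℕ n) ≡ false
      exc-top = cong (λ z → toℕ (fromℕ n) <ᵇ toℕ z) g-top ∙ ≥⇒<ᵇ-false (<⇒≤ (inject₁<fromℕ (f a)))
      exc-at : excᵇ g (inject₁ a) ≡ true
      exc-at = cong (λ z → toℕ (inject₁ a) <ᵇ toℕ z) g-at ∙ <⇒<ᵇ-true (inject₁<fromℕ a)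
      exc-other : ∀ i → i ≢ a → excᵇ g (inject₁ i) ≡ excᵇ f i
      exc-other i i≢a = cong₂ _<ᵇ_ (toℕ-inject₁ i) (cong toℕ (g-inject₁ i i≢a) ∙ toℕ-inject₁ (f i))

    ascent-other : ∀ z → z ≢ a → z ≢ f a → ascentᵇ g (inject₁ z) ≡ ascentᵇ f z
    ascent-other z z≢a z≢fa = does-⇔ (mk⇔ to from) (ascent? g (inject₁ z)) (ascent? f z)
      where
      to : (Σ _ λ w → g w ≡ inject₁ z × toℕ w < toℕ (inject₁ z)) → Σ _ λ w → f w ≡ z × toℕ w < toℕ z
      to (w , gw≡z , w<z) with case-of w
      ... | top = contradiction (sym (inject₁-injective (sym g-top ∙ gw≡z))) z≢fa
      ... | at = contradiction (sym g-at ∙ gw≡z) fromℕ≢inject₁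
      ... | other w′ w′≢a = w′ , inject₁-injective (sym (g-inject₁ w′ w′≢a) ∙ gw≡z) , subst₂ _<_ (toℕ-inject₁ w′) (toℕ-inject₁ z) w<z
      from : (Σ _ λ w → f w ≡ z × toℕ w < toℕ z) → Σ _ λ w → g w ≡ inject₁ z × toℕ w < toℕ (inject₁ z)
      from (w , fw≡z , w<z) = inject₁ w , g-inject₁ w (λ w≡a → z≢fa (sym fw≡z ∙ cong f w≡a)) ∙ cong inject₁ fw≡z
                            , subst₂ _<_ (sym (toℕ-inject₁ w)) (sym (toℕ-inject₁ z)) w<z

    peak-other : ∀ z → z ≢ a → z ≢ f a → peakᵇ g (inject₁ z) ≡ peakᵇ f z
    peak-other z z≢a z≢fa = peakᵇ-≡ g f (inject₁ z) z (ascent-other z z≢a z≢fa) (cong toℕ (g-inject₁ z z≢a) ∙ toℕ-inject₁ (f z))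
      (toℕ-inject₁ z) (cong (isCycleMinᵇ g) (g-inject₁ z z≢a) ∙ isCycleMin-inject₁ (f z))

    peak-top : peakᵇ g (fromℕ n) ≡ not (isCycleMinᵇ f (f a))
    peak-top = cong₂ _∧_ (ascentᵇ-true⇐ g (inject₁ a) g-at (inject₁<fromℕ a))
      (cong₂ _∧_ (cong (λ z → toℕ z <ᵇ toℕ (fromℕ n)) g-top ∙ <⇒<ᵇ-true (inject₁<fromℕ (f a)))
                 (cong not (cong (isCycleMinᵇ g) g-top ∙ isCycleMin-inject₁ (f a))))

    peak-at : peakᵇ g (inject₁ a) ≡ false
    peak-at = peakᵇ-no-descent g (inject₁ a) (cong (λ z → toℕ z <ᵇ toℕ (inject₁ a)) g-at ∙ ≥⇒<ᵇ-false (<⇒≤ (inject₁<fromℕ a)))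

    peak-after-top : peakᵇ g (inject₁ (f a)) ≡ false
    peak-after-top with ascentᵇ g (inject₁ (f a)) in asc
    ... | false = refl
    ... | true with ascentᵇ-true⇒ g _ asc
    ... | w , gw≡fa , w<fa = contradiction (subst (λ v → toℕ v < toℕ (inject₁ (f a))) (g-inj {w} {fromℕ n} (gw≡fa ∙ sym g-top)) w<fa)
            (<⇒≯ (inject₁<fromℕ (f a)))

    -- n becomes a peak unless it closes its cycle, while a and f a stop being peaks.
    peakCount≡ : peakCount g + 𝟙 (peakᵇ f a) + 𝟙 (peakᵇ f (f a)) ≡ peakCount f + 𝟙 (not (isCycleMinᵇ f (f a)))
    peakCount≡ = cong (λ z → z + 𝟙 (peakᵇ f a) + 𝟙 (peakᵇ f (f a)))
        (sum-init-last {n} (λ j → 𝟙 (peakᵇ g j)) ∙ cong (Σ-old +_) (cong 𝟙 peak-top))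
      ∙ solve 4 (λ h x p q → h :+ x :+ p :+ q := h :+ p :+ q :+ x) refl Σ-old X (𝟙 (peakᵇ f a)) (𝟙 (peakᵇ f (f a)))
      ∙ cong (_+ X) old-points
      where
      Σ-old = ∑[ i < n ] 𝟙 (peakᵇ g (inject₁ i))
      X = 𝟙 (not (isCycleMinᵇ f (f a)))
      old-points : Σ-old + 𝟙 (peakᵇ f a) + 𝟙 (peakᵇ f (f a)) ≡ peakCount f
      old-points with f a ≟ᶠ a
      ... | no fa≢a = ∑-update₂ (λ i → 𝟙 (peakᵇ g (inject₁ i))) (λ i → 𝟙 (peakᵇ f i)) a (f a) (λ a≡fa → fa≢a (sym a≡fa))
            (λ i i≢a i≢fa → cong 𝟙 (peak-other i i≢a i≢fa))
          ∙ cong₂ (λ p q → peakCount f + 𝟙 p + 𝟙 q) peak-at peak-after-top ∙ +-identityʳ _ ∙ +-identityʳ _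
      ... | yes fa≡a = cong (Σ-old + 𝟙 (peakᵇ f a) +_) (cong 𝟙 (cong (peakᵇ f) fa≡a ∙ fixed-not-peak)) ∙ +-identityʳ _
          ∙ ∑-update (λ i → 𝟙 (peakᵇ g (inject₁ i))) (λ i → 𝟙 (peakᵇ f i)) a
              (λ i i≢a → cong 𝟙 (peak-other i i≢a (λ i≡fa → i≢a (i≡fa ∙ fa≡a))))
          ∙ cong (λ p → peakCount f + 𝟙 p) peak-at ∙ +-identityʳ _
        where
        fixed-not-peak : peakᵇ f a ≡ false
        fixed-not-peak = peakᵇ-no-descent f a (cong (λ z → toℕ z <ᵇ toℕ a) fa≡a ∙ ≥⇒<ᵇ-false {toℕ a} ≤-refl)

module _ {n} {f : Fin n → Fin n} (f-inj : Injective _≡_ _≡_ f) where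

  createsPeak : Fin n → Bool
  createsPeak a = not (isCycleMinᵇ f (f a)) ∧ (not (peakᵇ f a) ∧ not (peakᵇ f (f a)))

  peak-descends : ∀ z → peakᵇ f z ≡ true → toℕ (f z) < toℕ z
  peak-descends z pk = <ᵇ-true⇒< (proj₁ (∧-true (proj₂ (∧-true {ascentᵇ f z} pk))))

  peak-of-image-ascends : ∀ a → peakᵇ f (f a) ≡ true → toℕ a < toℕ (f a)
  peak-of-image-ascends a pk = <ᵇ-true⇒< (sym (ascentᵇ-image f-inj a) ∙ proj₁ (∧-true pk))

  peak-successor-not-min : ∀ z → peakᵇ f z ≡ true → isCycleMinᵇ f (f z) ≡ false
  peak-successor-not-min z pk = not-true (proj₂ (∧-true (proj₂ (∧-true {ascentᵇ f z} pk))))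
    where
    not-true : ∀ {b} → not b ≡ true → b ≡ false
    not-true {false} _ = refl

  image-peak-not-min : ∀ a → peakᵇ f (f a) ≡ true → isCycleMinᵇ f (f a) ≡ false
  image-peak-not-min a pk = isCycleMinᵇ-false f-inj (f a) λ fa-min →
    let (j , back-to-a) = iterate-back f-inj a 1 in
    <⇒≱ (peak-of-image-ascends a pk) (subst (λ w → toℕ (f a) ≤ toℕ w) back-to-a (fa-min j))

  𝟙-not-cycleMin-split : ∀ a → 𝟙 (not (isCycleMinᵇ f (f a))) ≡ 𝟙 (createsPeak a) + 𝟙 (peakᵇ f a) + 𝟙 (peakᵇ f (f a))
  𝟙-not-cycleMin-split a = split (isCycleMinᵇ f (f a)) (peakᵇ f a) (peakᵇ f (f a))
    (peak-successor-not-min a) (image-peak-not-min a)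
    (λ pk-a pk-fa → <-asym (peak-descends a pk-a) (peak-of-image-ascends a pk-fa))
    where
    split : ∀ c p q → (p ≡ true → c ≡ false) → (q ≡ true → c ≡ false) → (p ≡ true → q ≡ true → ⊥) →
      𝟙 (not c) ≡ 𝟙 (not c ∧ (not p ∧ not q)) + 𝟙 p + 𝟙 q
    split true true _ p⇒ _ _ = case p⇒ refl of λ ()
    split true false true _ q⇒ _ = case q⇒ refl of λ ()
    split true false false _ _ _ = refl
    split false true true _ _ excl = ⊥-elim (excl refl refl)
    split false true false _ _ _ = refl
    split false false true _ _ _ = refl
    split false false false _ _ _ = refl

  peakCount-insertAfter : ∀ a → peakCount (InsertAfter.g f a) ≡ peakCount f + 𝟙 (createsPeak a)
  peakCount-insertAfter a = +-cancelʳ-≡ (𝟙 (peakᵇ f a) + 𝟙 (peakᵇ f (f a))) _ _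
    (sym (+-assoc (peakCount (InsertAfter.g f a)) _ _)
     ∙ InsertAfter.peakCount≡ f a f-inj ∙ cong (peakCount f +_) (𝟙-not-cycleMin-split a)
     ∙ solve 4 (λ C D P Q → C :+ (D :+ P :+ Q) := C :+ D :+ (P :+ Q)) refl (peakCount f) (𝟙 (createsPeak a)) (𝟙 (peakᵇ f a)) (𝟙 (peakᵇ f (f a))))

  -- f a is not a cycle minimum exactly when a is a peak, f a is a peak, or inserting after a creates one.
  createsPeak-count : ∑[ a < n ] 𝟙 (createsPeak a) + (cycCount f + 2 * peakCount f) ≡ n
  createsPeak-count = sym (begin
    n
      ≡⟨ sym (∑-one n) ⟩
    ∑[ a < n ] 1
      ≡⟨ sum-cong-≗ {n} (λ a → sym (𝟙-+-𝟙-not (isCycleMinᵇ f (f a))) ∙ cong (𝟙 (isCycleMinᵇ f (f a)) +_) (𝟙-not-cycleMin-split a)) ⟩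
    ∑[ a < n ] (𝟙 (isCycleMinᵇ f (f a)) + (𝟙 (createsPeak a) + 𝟙 (peakᵇ f a) + 𝟙 (peakᵇ f (f a))))
      ≡⟨ ∑-distrib-+ {n} (λ a → 𝟙 (isCycleMinᵇ f (f a))) (λ a → 𝟙 (createsPeak a) + 𝟙 (peakᵇ f a) + 𝟙 (peakᵇ f (f a)))
         ∙ cong (∑[ a < n ] 𝟙 (isCycleMinᵇ f (f a)) +_)
             (∑-distrib-+ {n} (λ a → 𝟙 (createsPeak a) + 𝟙 (peakᵇ f a)) (λ a → 𝟙 (peakᵇ f (f a)))
              ∙ cong (_+ ∑[ a < n ] 𝟙 (peakᵇ f (f a))) (∑-distrib-+ {n} (λ a → 𝟙 (createsPeak a)) (λ a → 𝟙 (peakᵇ f a)))) ⟩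
    ∑[ a < n ] 𝟙 (isCycleMinᵇ f (f a)) + (C + peakCount f + ∑[ a < n ] 𝟙 (peakᵇ f (f a)))
      ≡⟨ cong₂ (λ x y → x + (C + peakCount f + y)) (∑-reindex f-inj (λ y → 𝟙 (isCycleMinᵇ f y))) (∑-reindex f-inj (λ z → 𝟙 (peakᵇ f z))) ⟩
    cycCount f + (C + peakCount f + peakCount f)
      ≡⟨ solve 3 (λ c d p → c :+ (d :+ p :+ p) := d :+ (c :+ con 2 :* p)) refl (cycCount f) C (peakCount f) ⟩
    C + (cycCount f + 2 * peakCount f) ∎)
    where
    C = ∑[ a < n ] 𝟙 (createsPeak a)

insertMax : ∀ {n} → (Fin n → Fin n) → Fin (suc n) → Fin (suc n) → Fin (suc n)
insertMax f a with view a
... | ‵fromℕ = AddFixedPoint.g f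
... | ‵inject₁ a₀ = InsertAfter.g f a₀

insertMax-top : ∀ {n} (f : Fin n → Fin n) → insertMax f (fromℕ n) ≗ AddFixedPoint.g f
insertMax-top {n} f j rewrite view-fromℕ n = refl

insertMax-inject₁ : ∀ {n} (f : Fin n → Fin n) a₀ → insertMax f (inject₁ a₀) ≗ InsertAfter.g f a₀
insertMax-inject₁ f a₀ j rewrite view-inject₁ a₀ = refl

insertMax-inj : ∀ {n} {f : Fin n → Fin n} → Injective _≡_ _≡_ f → ∀ a → Injective _≡_ _≡_ (insertMax f a)
insertMax-inj {f = f} f-inj a with view a
... | ‵fromℕ = AddFixedPoint.g-inj f f-inj
... | ‵inject₁ a₀ = InsertAfter.g-inj f a₀ f-inj

insertMax-at : ∀ {n} (f : Fin n → Fin n) a → insertMax f a a ≡ fromℕ n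
insertMax-at f a with view a
... | ‵fromℕ = AddFixedPoint.g-top f
... | ‵inject₁ a₀ = InsertAfter.g-at f a₀

insertMax-hits-top : ∀ {n} (f : Fin n → Fin n) a j → insertMax f a j ≡ fromℕ n → j ≡ a
insertMax-hits-top {n} f a j hits with view a
... | ‵fromℕ with view j
...   | ‵fromℕ = refl
...   | ‵inject₁ i = contradiction (sym hits) fromℕ≢inject₁
insertMax-hits-top {n} f a j hits | ‵inject₁ a₀ with InsertAfter.case-of f a₀ j
... | InsertAfter.top = contradiction (sym (sym (InsertAfter.g-top f a₀) ∙ hits)) fromℕ≢inject₁
... | InsertAfter.at = refl
... | InsertAfter.other i i≢a₀ = contradiction (sym (sym (InsertAfter.g-inject₁ f a₀ i i≢a₀) ∙ hits)) fromℕ≢inject₁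

insertᵥ : ∀ {n} → Perm n → Fin (suc n) → Perm (suc n)
insertᵥ π a = tabulateᵥ (insertMax (lookup π) a)

lookup-insertᵥ : ∀ {n} (π : Perm n) a → lookup (insertᵥ π a) ≗ insertMax (lookup π) a
lookup-insertᵥ π a = lookup∘tabulate (insertMax (lookup π) a)

insertᵥ-injective : ∀ {n} {π π′ : Perm n} {a a′} → insertᵥ π a ≡ insertᵥ π′ a′ → π ≡ π′ × a ≡ a′
insertᵥ-injective {n} {π} {π′} {a} {a′} eq = lookup-ext same-map , a≡a′
  where
  lookup-ext : ∀ {u v : Perm n} → lookup u ≗ lookup v → u ≡ v
  lookup-ext {u} {v} u≗v = sym (tabulate∘lookup u) ∙ tabulate-cong u≗v ∙ tabulate∘lookup v
  same : ∀ j → insertMax (lookup π) a j ≡ insertMax (lookup π′) a′ j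
  same j = sym (lookup-insertᵥ π a j) ∙ cong (λ v → lookup v j) eq ∙ lookup-insertᵥ π′ a′ j
  a≡a′ : a ≡ a′
  a≡a′ = sym (insertMax-hits-top (lookup π) a a′ (same a′ ∙ insertMax-at (lookup π′) a′))
  same-at-a : ∀ j → insertMax (lookup π) a j ≡ insertMax (lookup π′) a j
  same-at-a j = same j ∙ cong (λ b → insertMax (lookup π′) b j) (sym a≡a′)
  same-map : lookup π ≗ lookup π′
  same-map i with view a | same-at-a
  ... | ‵fromℕ | same′ = inject₁-injective (sym (AddFixedPoint.g-inject₁ (lookup π) i) ∙ same′ (inject₁ i) ∙ AddFixedPoint.g-inject₁ (lookup π′) i)
  ... | ‵inject₁ a₀ | same′ with i ≟ᶠ a₀
  ...   | yes refl = inject₁-injective (sym (InsertAfter.g-top (lookup π) i) ∙ same′ (fromℕ n) ∙ InsertAfter.g-top (lookup π′) i)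
  ...   | no i≢a₀ = inject₁-injective (sym (InsertAfter.g-inject₁ (lookup π) a₀ i i≢a₀) ∙ same′ (inject₁ i)
                      ∙ InsertAfter.g-inject₁ (lookup π′) a₀ i i≢a₀)

lowerOr : ∀ {n} → Fin n → Fin (suc n) → Fin n
lowerOr d j with view j
... | ‵fromℕ = d
... | ‵inject₁ i = i

inject₁-lowerOr : ∀ {n} (d : Fin n) j → j ≢ fromℕ n → inject₁ (lowerOr d j) ≡ j
inject₁-lowerOr d j j≢top with view j
... | ‵fromℕ = contradiction refl j≢top
... | ‵inject₁ i = refl

module RemoveMax {n} (G : Fin (suc n) → Fin (suc n)) (G-inj : Injective _≡_ _≡_ G) where

  skip : Fin (suc n) → Fin (suc n)
  skip j = if does (G j ≟ᶠ fromℕ n) then G (fromℕ n) else G j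

  f : Fin n → Fin n
  f i = lowerOr i (skip (inject₁ i))

  skip-misses-top : ∀ i → skip (inject₁ i) ≢ fromℕ n
  skip-misses-top i with G (inject₁ i) ≟ᶠ fromℕ n
  ... | yes Gi≡top = λ Gtop≡top → fromℕ≢inject₁ (sym (G-inj (Gi≡top ∙ sym Gtop≡top)))
  ... | no Gi≢top = Gi≢top

  π : Perm n
  π = tabulateᵥ f

  inject₁-π : ∀ i → inject₁ (lookup π i) ≡ skip (inject₁ i)
  inject₁-π i = cong inject₁ (lookup∘tabulate f i) ∙ inject₁-lowerOr i _ (skip-misses-top i)

  skip-at : ∀ i → G (inject₁ i) ≡ fromℕ n → skip (inject₁ i) ≡ G (fromℕ n)
  skip-at i Gi≡top rewrite dec-true (G (inject₁ i) ≟ᶠ fromℕ n) Gi≡top = refl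

  skip-other : ∀ i → G (inject₁ i) ≢ fromℕ n → skip (inject₁ i) ≡ G (inject₁ i)
  skip-other i Gi≢top rewrite dec-false (G (inject₁ i) ≟ᶠ fromℕ n) Gi≢top = refl

  π-inj : Injective _≡_ _≡_ (lookup π)
  π-inj {i} {j} eq with G (inject₁ i) ≟ᶠ fromℕ n | G (inject₁ j) ≟ᶠ fromℕ n | skip≡
    where skip≡ = sym (inject₁-π i) ∙ cong inject₁ eq ∙ inject₁-π j
  ... | yes Gi | yes Gj | _ = inject₁-injective (G-inj (Gi ∙ sym Gj))
  ... | yes _ | no _ | s = contradiction (G-inj s) fromℕ≢inject₁
  ... | no _ | yes _ | s = contradiction (sym (G-inj s)) fromℕ≢inject₁
  ... | no _ | no _ | s = inject₁-injective (G-inj s)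

  reinsert : ∀ a → G a ≡ fromℕ n → insertMax (lookup π) a ≗ G
  reinsert a Ga≡top j with view a
  ... | ‵fromℕ with view j
  ...   | ‵fromℕ = sym Ga≡top
  ...   | ‵inject₁ i = inject₁-π i ∙ skip-other i (λ Gi≡top → fromℕ≢inject₁ (G-inj (Ga≡top ∙ sym Gi≡top)))
  reinsert a Ga≡top j | ‵inject₁ a₀ with InsertAfter.case-of (lookup π) a₀ j
  ... | InsertAfter.top = InsertAfter.g-top (lookup π) a₀ ∙ inject₁-π a₀ ∙ skip-at a₀ Ga≡top
  ... | InsertAfter.at = InsertAfter.g-at (lookup π) a₀ ∙ sym Ga≡top
  ... | InsertAfter.other i i≢a₀ = InsertAfter.g-inject₁ (lookup π) a₀ i i≢a₀ ∙ inject₁-π i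
      ∙ skip-other i (λ Gi≡top → i≢a₀ (inject₁-injective (G-inj (Gi≡top ∙ sym Ga≡top))))

concatMap-map≡cartesianProductWith : ∀ {A B C : Set} (h : A → B → C) xs ys →
  concatMap (λ x → map (h x) ys) xs ≡ cartesianProductWith h xs ys
concatMap-map≡cartesianProductWith h [] ys = refl
concatMap-map≡cartesianProductWith h (x ∷ xs) ys = cong (map (h x) ys ++_) (concatMap-map≡cartesianProductWith h xs ys)

allVecs-unique : ∀ n k → Unique (allVecs n k)
allVecs-unique n zero = All.[] AllPairs.∷ AllPairs.[]
allVecs-unique n (suc k) = subst Unique (sym (concatMap-map≡cartesianProductWith _∷ᵥ_ (allFin n) (allVecs n k)))
  (cartesianProductWith⁺ _∷ᵥ_ ∷-injective (allFin⁺ n) (allVecs-unique n k))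

allVecs-complete : ∀ n k (v : Vec (Fin n) k) → v ∈ allVecs n k
allVecs-complete n zero []ᵥ = here refl
allVecs-complete n (suc k) (a ∷ᵥ v) = subst (_ ∈_) (sym (concatMap-map≡cartesianProductWith _∷ᵥ_ (allFin n) (allVecs n k)))
  (∈-cartesianProductWith⁺ _∷ᵥ_ (∈-allFin a) (allVecs-complete n k v))

module _ {n} (v : Perm n) where

  injective?-sound : injective? v ≡ true → Injective _≡_ _≡_ (lookup v)
  injective?-sound all-ok {i} {j} vi≡vj with lookup v i ≟ᶠ lookup v j | foldr-∧-true⇒ _ (foldr-∧-true⇒ _ all-ok (∈-allFin i)) (∈-allFin j)
  ... | no vi≢vj | _ = contradiction vi≡vj vi≢vj
  ... | yes _ | ok with i ≟ᶠ j
  ...   | yes i≡j = i≡j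

  injective?-complete : Injective _≡_ _≡_ (lookup v) → injective? v ≡ true
  injective?-complete v-inj = foldr-∧-true⇐ _ (allFin n) λ {i} _ → foldr-∧-true⇐ _ (allFin n) λ {j} _ → pair-ok i j
    where
    pair-ok : ∀ i j → (not ⌊ lookup v i ≟ᶠ lookup v j ⌋ ∨ ⌊ i ≟ᶠ j ⌋) ≡ true
    pair-ok i j with lookup v i ≟ᶠ lookup v j
    ... | no _ = refl
    ... | yes vi≡vj with i ≟ᶠ j
    ...   | yes _ = refl
    ...   | no i≢j = contradiction (v-inj vi≡vj) i≢j

  ∈-S⁺ : Injective _≡_ _≡_ (lookup v) → v ∈ S n
  ∈-S⁺ v-inj = ∈-filter⁺ (λ v → injective? v Bool.≟ true) (allVecs-complete n n v) (injective?-complete v-inj)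

  ∈-S⁻ : v ∈ S n → Injective _≡_ _≡_ (lookup v)
  ∈-S⁻ v∈S = injective?-sound (proj₂ (∈-filter⁻ (λ v → injective? v Bool.≟ true) {xs = allVecs n n} v∈S))

S-unique : ∀ n → Unique (S n)
S-unique n = filter⁺ _ (allVecs-unique n n)

sum-S-suc : ∀ n (F : Perm (suc n) → ℕ) → sum (map F (S (suc n))) ≡ sum (map (λ π → ∑[ a < suc n ] F (insertᵥ π a)) (S n))
sum-S-suc n F = sum-map-unique (S-unique (suc n)) insertions-unique S⊆insertions insertions⊆S F
  ∙ cong (λ l → sum (map F l)) (sym (concatMap-map≡cartesianProductWith insertᵥ (S n) (allFin (suc n))))
  ∙ sum-concatMap (λ π → map (insertᵥ π) (allFin (suc n))) (S n) F
  ∙ sum-map-cong (S n) (λ π _ → sum-map-∘ (insertᵥ π) F (allFin (suc n)) ∙ sum-allFin (suc n) (λ a → F (insertᵥ π a)))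
  where
  insertions = cartesianProductWith insertᵥ (S n) (allFin (suc n))
  insertions-unique : Unique insertions
  insertions-unique = cartesianProductWith⁺ insertᵥ insertᵥ-injective (S-unique n) (allFin⁺ (suc n))
  S⊆insertions : ∀ {v} → v ∈ S (suc n) → v ∈ insertions
  S⊆insertions {v} v∈S = subst (_∈ insertions) reinserted (∈-cartesianProductWith⁺ insertᵥ (∈-S⁺ π π-inj) (∈-allFin a))
    where
    open RemoveMax (lookup v) (∈-S⁻ v v∈S)
    a = proj₁ (preimage (∈-S⁻ v v∈S) (fromℕ n))
    reinserted : insertᵥ π a ≡ v
    reinserted = tabulate-cong (reinsert a (proj₂ (preimage (∈-S⁻ v v∈S) (fromℕ n)))) ∙ tabulate∘lookup v
  insertions⊆S : ∀ {v} → v ∈ insertions → v ∈ S (suc n)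
  insertions⊆S v∈ with ∈-cartesianProductWith⁻ insertᵥ (S n) (allFin (suc n)) v∈
  ... | π , a , π∈S , _ , refl = ∈-S⁺ (insertᵥ π a) λ {i} {j} eq →
    insertMax-inj (∈-S⁻ π π∈S) a (sym (lookup-insertᵥ π a i) ∙ eq ∙ lookup-insertᵥ π a j)

𝟙-≡ᵇ-subst : ∀ a b (X Y : ℕ) → (a ≡ b → X ≡ Y) → 𝟙 (a ≡ᵇ b) * X ≡ 𝟙 (a ≡ᵇ b) * Y
𝟙-≡ᵇ-subst a b X Y a≡b⇒X≡Y with a ≡ᵇ b in eq
... | true = cong (1 *_) (a≡b⇒X≡Y (≡ᵇ⇒≡ a b (subst T (sym eq) _)))
... | false = refl

-- The left side counts insertions into a permutation with x excedances and weight w: after one of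
-- the x excedances exc is kept, after one of the k other points it grows by one, and both double the
-- weight; the new fixed point keeps exc and the weight.
exc-insertion-sum : ∀ n x k e w → x + k ≡ n →
  x * (𝟙 (x ≡ᵇ e) * (2 * w)) + k * (𝟙 (suc x ≡ᵇ e) * (2 * w)) + 𝟙 (x ≡ᵇ e) * w
  ≡ suc (2 * e) * (𝟙 (x ≡ᵇ e) * w) + previous (λ e′ → 2 * (n ∸ e′) * (𝟙 (x ≡ᵇ e′) * w)) e
exc-insertion-sum n x k zero w _ = begin
  x * (I * (2 * w)) + k * (0 * (2 * w)) + I * w
    ≡⟨ solve 4 (λ x k I w → x :* (I :* (con 2 :* w)) :+ k :* (con 0 :* (con 2 :* w)) :+ I :* w := I :* (x :* (con 2 :* w) :+ w)) refl x k I w ⟩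
  I * (x * (2 * w) + w)
    ≡⟨ 𝟙-≡ᵇ-subst x 0 _ (0 * (2 * w) + w) (λ x≡0 → cong (λ z → z * (2 * w) + w) x≡0) ⟩
  I * (0 * (2 * w) + w)
    ≡⟨ solve 2 (λ I w → I :* (con 0 :* (con 2 :* w) :+ w) := (con 1 :+ con 2 :* con 0) :* (I :* w) :+ con 0) refl I w ⟩
  suc (2 * 0) * (I * w) + 0 ∎
  where
  I = 𝟙 (x ≡ᵇ 0)
exc-insertion-sum n x k (suc e) w x+k≡n = begin
  x * (I * (2 * w)) + k * (I′ * (2 * w)) + I * w
    ≡⟨ solve 5 (λ x k I I′ w → x :* (I :* (con 2 :* w)) :+ k :* (I′ :* (con 2 :* w)) :+ I :* w
         := I :* (x :* (con 2 :* w) :+ w) :+ I′ :* (k :* (con 2 :* w))) refl x k I I′ w ⟩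
  I * (x * (2 * w) + w) + I′ * (k * (2 * w))
    ≡⟨ cong₂ _+_ (𝟙-≡ᵇ-subst x (suc e) _ (suc e * (2 * w) + w) (λ x≡1+e → cong (λ z → z * (2 * w) + w) x≡1+e))
                 (𝟙-≡ᵇ-subst x e _ ((n ∸ e) * (2 * w)) (λ x≡e → cong (_* (2 * w)) (sym (m+n∸m≡n x k) ∙ cong₂ _∸_ x+k≡n x≡e))) ⟩
  I * (suc e * (2 * w) + w) + I′ * ((n ∸ e) * (2 * w))
    ≡⟨ solve 5 (λ e d I I′ w → I :* ((con 1 :+ e) :* (con 2 :* w) :+ w) :+ I′ :* (d :* (con 2 :* w))
         := (con 1 :+ con 2 :* (con 1 :+ e)) :* (I :* w) :+ con 2 :* d :* (I′ :* w)) refl e (n ∸ e) I I′ w ⟩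
  suc (2 * suc e) * (I * w) + 2 * (n ∸ e) * (I′ * w) ∎
  where
  I = 𝟙 (x ≡ᵇ suc e)
  I′ = 𝟙 (x ≡ᵇ e)

-- The left side counts insertions into a permutation with m cycle runs and weight v: k insertions
-- create a peak (two more runs, weight times 4), the other m keep both, and the new fixed point adds a run.
crun-insertion-sum : ∀ n m k M v → k + m ≡ n →
  k * (𝟙 (suc (suc m) ≡ᵇ M) * (4 * v)) + m * (𝟙 (m ≡ᵇ M) * v) + 𝟙 (suc m ≡ᵇ M) * v
  ≡ previous (λ M′ → 𝟙 (m ≡ᵇ M′) * v) M + M * (𝟙 (m ≡ᵇ M) * v) + previous (previous (λ M′ → 4 * (n ∸ M′) * (𝟙 (m ≡ᵇ M′) * v))) M
crun-insertion-sum n m k zero v _ = begin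
  k * (0 * (4 * v)) + m * (I * v) + 0 * v
    ≡⟨ solve 4 (λ k m I v → k :* (con 0 :* (con 4 :* v)) :+ m :* (I :* v) :+ con 0 :* v := I :* (m :* v)) refl k m I v ⟩
  I * (m * v)
    ≡⟨ 𝟙-≡ᵇ-subst m 0 (m * v) (0 * v) (λ m≡0 → cong (_* v) m≡0) ⟩
  I * (0 * v)
    ≡⟨ solve 2 (λ I v → I :* (con 0 :* v) := con 0 :+ con 0 :* (I :* v) :+ con 0) refl I v ⟩
  0 + 0 * (I * v) + 0 ∎
  where
  I = 𝟙 (m ≡ᵇ 0)
crun-insertion-sum n m k (suc zero) v _ = begin
  k * (0 * (4 * v)) + m * (I * v) + I′ * v
    ≡⟨ solve 5 (λ k m I I′ v → k :* (con 0 :* (con 4 :* v)) :+ m :* (I :* v) :+ I′ :* v := I′ :* v :+ I :* (m :* v)) refl k m I I′ v ⟩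
  I′ * v + I * (m * v)
    ≡⟨ cong (I′ * v +_) (𝟙-≡ᵇ-subst m 1 (m * v) (1 * v) (λ m≡1 → cong (_* v) m≡1)) ⟩
  I′ * v + I * (1 * v)
    ≡⟨ solve 3 (λ I I′ v → I′ :* v :+ I :* (con 1 :* v) := I′ :* v :+ con 1 :* (I :* v) :+ con 0) refl I I′ v ⟩
  I′ * v + 1 * (I * v) + 0 ∎
  where
  I = 𝟙 (m ≡ᵇ 1)
  I′ = 𝟙 (m ≡ᵇ 0)
crun-insertion-sum n m k (suc (suc M)) v k+m≡n = begin
  k * (I″ * (4 * v)) + m * (I * v) + I′ * v
    ≡⟨ solve 6 (λ k m I I′ I″ v → k :* (I″ :* (con 4 :* v)) :+ m :* (I :* v) :+ I′ :* v
         := I′ :* v :+ I :* (m :* v) :+ I″ :* (k :* (con 4 :* v))) refl k m I I′ I″ v ⟩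
  I′ * v + I * (m * v) + I″ * (k * (4 * v))
    ≡⟨ cong₂ (λ a b → I′ * v + a + b) (𝟙-≡ᵇ-subst m (suc (suc M)) (m * v) (suc (suc M) * v) (λ m≡2+M → cong (_* v) m≡2+M))
         (𝟙-≡ᵇ-subst m M (k * (4 * v)) ((n ∸ M) * (4 * v)) (λ m≡M → cong (_* (4 * v)) (sym (m+n∸n≡m k m) ∙ cong₂ _∸_ k+m≡n m≡M))) ⟩
  I′ * v + I * (suc (suc M) * v) + I″ * ((n ∸ M) * (4 * v))
    ≡⟨ solve 6 (λ M d I I′ I″ v → I′ :* v :+ I :* ((con 2 :+ M) :* v) :+ I″ :* (d :* (con 4 :* v))
         := I′ :* v :+ (con 2 :+ M) :* (I :* v) :+ con 4 :* d :* (I″ :* v)) refl M (n ∸ M) I I′ I″ v ⟩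
  I′ * v + suc (suc M) * (I * v) + 4 * (n ∸ M) * (I″ * v) ∎
  where
  I = 𝟙 (m ≡ᵇ suc (suc M))
  I′ = 𝟙 (m ≡ᵇ suc M)
  I″ = 𝟙 (m ≡ᵇ M)

crunTerm : ∀ {n} → Perm n → ℕ → ℕ
crunTerm π m = 𝟙 (crun π ≡ᵇ m) * 2 ^ (crun π ∸ cyc π)

crun-weight-local : ∀ {m} (σ : Perm m) → Injective _≡_ _≡_ (lookup σ) → ∀ M →
  crunTerm σ M ≡ 𝟙 ((cycCount (lookup σ) + 2 * peakCount (lookup σ)) ≡ᵇ M) * 2 ^ (2 * peakCount (lookup σ))
crun-weight-local σ σ-inj M = cong₂ (λ r c → 𝟙 (r ≡ᵇ M) * 2 ^ (r ∸ c)) (crun≡cycCount+2*peakCount σ σ-inj) (cyc≡cycCount σ)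
  ∙ cong (λ z → 𝟙 ((cycCount (lookup σ) + 2 * peakCount (lookup σ)) ≡ᵇ M) * 2 ^ z) (m+n∸m≡n (cycCount (lookup σ)) _)

module Insertion {n} (π : Perm n) (π-inj : Injective _≡_ _≡_ (lookup π)) where
  private
    f = lookup π

  m v : ℕ
  m = cycCount f + 2 * peakCount f
  v = 2 ^ (2 * peakCount f)

  inserted-inj : ∀ a → Injective _≡_ _≡_ (lookup (insertᵥ π a))
  inserted-inj a {i} {j} eq = insertMax-inj π-inj a (sym (lookup-insertᵥ π a i) ∙ eq ∙ lookup-insertᵥ π a j)

  at-top : lookup (insertᵥ π (fromℕ n)) ≗ AddFixedPoint.g f
  at-top j = lookup-insertᵥ π (fromℕ n) j ∙ insertMax-top f j

  at-inject₁ : ∀ a₀ → lookup (insertᵥ π (inject₁ a₀)) ≗ InsertAfter.g f a₀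
  at-inject₁ a₀ j = lookup-insertᵥ π (inject₁ a₀) j ∙ insertMax-inject₁ f a₀ j

  exc-top : exc (insertᵥ π (fromℕ n)) ≡ excCount f
  exc-top = exc≡excCount (insertᵥ π (fromℕ n)) ∙ excCount-cong at-top ∙ AddFixedPoint.excCount≡ f π-inj

  cyc-top : cyc (insertᵥ π (fromℕ n)) ≡ suc (cycCount f)
  cyc-top = cyc≡cycCount (insertᵥ π (fromℕ n)) ∙ cycCount-cong at-top ∙ AddFixedPoint.cycCount≡ f π-inj ∙ +-comm (cycCount f) 1

  peaks-top : peakCount (lookup (insertᵥ π (fromℕ n))) ≡ peakCount f
  peaks-top = peakCount-cong at-top ∙ AddFixedPoint.peakCount≡ f π-inj

  exc-after : ∀ a₀ → exc (insertᵥ π (inject₁ a₀)) ≡ excCount f + 𝟙 (not (excᵇ f a₀))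
  exc-after a₀ = exc≡excCount (insertᵥ π (inject₁ a₀)) ∙ excCount-cong (at-inject₁ a₀) ∙ +-cancelʳ-≡ (𝟙 (excᵇ f a₀)) _ _
    (InsertAfter.excCount≡ f a₀ π-inj ∙ cong (excCount f +_) (sym (+-comm (𝟙 (not (excᵇ f a₀))) _ ∙ 𝟙-+-𝟙-not (excᵇ f a₀)))
     ∙ sym (+-assoc (excCount f) _ _))

  cyc-after : ∀ a₀ → cyc (insertᵥ π (inject₁ a₀)) ≡ cycCount f
  cyc-after a₀ = cyc≡cycCount (insertᵥ π (inject₁ a₀)) ∙ cycCount-cong (at-inject₁ a₀) ∙ InsertAfter.cycCount≡ f a₀ π-inj

  peaks-after : ∀ a₀ → peakCount (lookup (insertᵥ π (inject₁ a₀))) ≡ peakCount f + 𝟙 (createsPeak π-inj a₀)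
  peaks-after a₀ = peakCount-cong (at-inject₁ a₀) ∙ peakCount-insertAfter π-inj a₀

  exc-weights : ∀ e → ∑[ a < suc n ] (𝟙 (exc (insertᵥ π a) ≡ᵇ e) * 2 ^ (suc n ∸ cyc (insertᵥ π a)))
    ≡ suc (2 * e) * (𝟙 (exc π ≡ᵇ e) * 2 ^ (n ∸ cyc π)) + previous (λ e′ → 2 * (n ∸ e′) * (𝟙 (exc π ≡ᵇ e′) * 2 ^ (n ∸ cyc π))) e
  exc-weights e = begin
    ∑[ a < suc n ] h a
      ≡⟨ sum-init-last {n} h ⟩
    ∑[ a₀ < n ] h (inject₁ a₀) + h (fromℕ n)
      ≡⟨ cong₂ _+_ (sum-cong-≗ {n} h-after ∙ ∑-by-bool (excᵇ f) G) h-top ⟩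
    x * G true + k * G false + 𝟙 (x ≡ᵇ e) * w
      ≡⟨ cong₂ (λ a b → x * (𝟙 (a ≡ᵇ e) * (2 * w)) + k * (𝟙 (b ≡ᵇ e) * (2 * w)) + 𝟙 (x ≡ᵇ e) * w) (+-identityʳ x) (+-comm x 1) ⟩
    x * (𝟙 (x ≡ᵇ e) * (2 * w)) + k * (𝟙 (suc x ≡ᵇ e) * (2 * w)) + 𝟙 (x ≡ᵇ e) * w
      ≡⟨ exc-insertion-sum n x k e w (∑-𝟙-+-∑-𝟙-not (excᵇ f)) ⟩
    suc (2 * e) * (𝟙 (x ≡ᵇ e) * w) + previous (λ e′ → 2 * (n ∸ e′) * (𝟙 (x ≡ᵇ e′) * w)) e
      ≡⟨ cong₂ (λ x c → suc (2 * e) * (𝟙 (x ≡ᵇ e) * 2 ^ (n ∸ c)) + previous (λ e′ → 2 * (n ∸ e′) * (𝟙 (x ≡ᵇ e′) * 2 ^ (n ∸ c))) e)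
           (sym (exc≡excCount π)) (sym (cyc≡cycCount π)) ⟩
    suc (2 * e) * (𝟙 (exc π ≡ᵇ e) * 2 ^ (n ∸ cyc π)) + previous (λ e′ → 2 * (n ∸ e′) * (𝟙 (exc π ≡ᵇ e′) * 2 ^ (n ∸ cyc π))) e ∎
    where
    h : Fin (suc n) → ℕ
    h a = 𝟙 (exc (insertᵥ π a) ≡ᵇ e) * 2 ^ (suc n ∸ cyc (insertᵥ π a))
    x = excCount f
    k = ∑[ i < n ] 𝟙 (not (excᵇ f i))
    w = 2 ^ (n ∸ cycCount f)
    G : Bool → ℕ
    G b = 𝟙 ((x + 𝟙 (not b)) ≡ᵇ e) * (2 * w)
    h-top : h (fromℕ n) ≡ 𝟙 (x ≡ᵇ e) * w
    h-top = cong₂ (λ x c → 𝟙 (x ≡ᵇ e) * 2 ^ (suc n ∸ c)) exc-top cyc-top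
    h-after : ∀ a₀ → h (inject₁ a₀) ≡ G (excᵇ f a₀)
    h-after a₀ = cong₂ (λ x c → 𝟙 (x ≡ᵇ e) * 2 ^ (suc n ∸ c)) (exc-after a₀) (cyc-after a₀)
      ∙ cong (λ z → 𝟙 ((x + 𝟙 (not (excᵇ f a₀))) ≡ᵇ e) * 2 ^ z) (+-∸-assoc 1 (∑-𝟙≤ (isCycleMinᵇ f)))

  crun-weights : ∀ M → ∑[ a < suc n ] (𝟙 (crun (insertᵥ π a) ≡ᵇ M) * 2 ^ (crun (insertᵥ π a) ∸ cyc (insertᵥ π a)))
    ≡ previous (crunTerm π) M + M * crunTerm π M + previous (previous (λ M′ → 4 * (n ∸ M′) * crunTerm π M′)) M
  crun-weights M = begin
    ∑[ a < suc n ] (𝟙 (crun (insertᵥ π a) ≡ᵇ M) * 2 ^ (crun (insertᵥ π a) ∸ cyc (insertᵥ π a)))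
      ≡⟨ sum-cong-≗ {suc n} (λ a → crun-weight-local (insertᵥ π a) (inserted-inj a) M) ∙ sum-init-last {n} h ⟩
    ∑[ a₀ < n ] h (inject₁ a₀) + h (fromℕ n)
      ≡⟨ cong₂ _+_ (sum-cong-≗ {n} h-after ∙ ∑-by-bool (createsPeak π-inj) G) h-top ⟩
    kδ * G true + knot * G false + 𝟙 (suc m ≡ᵇ M) * v
      ≡⟨ cong₂ (λ a b → kδ * a + b + 𝟙 (suc m ≡ᵇ M) * v) G-true (cong₂ _*_ knot≡m G-false) ⟩
    kδ * (𝟙 (suc (suc m) ≡ᵇ M) * (4 * v)) + m * (𝟙 (m ≡ᵇ M) * v) + 𝟙 (suc m ≡ᵇ M) * v
      ≡⟨ crun-insertion-sum n m kδ M v (cong (kδ +_) (sym knot≡m) ∙ ∑-𝟙-+-∑-𝟙-not (createsPeak π-inj)) ⟩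
    previous (λ M′ → 𝟙 (m ≡ᵇ M′) * v) M + M * (𝟙 (m ≡ᵇ M) * v) + previous (previous (λ M′ → 4 * (n ∸ M′) * (𝟙 (m ≡ᵇ M′) * v))) M
      ≡⟨ cong₂ _+_ (cong₂ _+_ (previous-cong local M) (cong (M *_) (local M)))
                   (previous-cong (previous-cong (λ M′ → cong (4 * (n ∸ M′) *_) (local M′))) M) ⟩
    previous (crunTerm π) M + M * crunTerm π M + previous (previous (λ M′ → 4 * (n ∸ M′) * crunTerm π M′)) M ∎
    where
    c = cycCount f
    p = peakCount f
    h : Fin (suc n) → ℕ
    h a = 𝟙 ((cycCount (lookup (insertᵥ π a)) + 2 * peakCount (lookup (insertᵥ π a))) ≡ᵇ M) * 2 ^ (2 * peakCount (lookup (insertᵥ π a)))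
    G : Bool → ℕ
    G b = 𝟙 ((c + 2 * (p + 𝟙 b)) ≡ᵇ M) * 2 ^ (2 * (p + 𝟙 b))
    kδ = ∑[ a₀ < n ] 𝟙 (createsPeak π-inj a₀)
    knot = ∑[ a₀ < n ] 𝟙 (not (createsPeak π-inj a₀))
    knot≡m : knot ≡ m
    knot≡m = +-cancelˡ-≡ kδ _ _ (∑-𝟙-+-∑-𝟙-not (createsPeak π-inj) ∙ sym (createsPeak-count π-inj))
    h-top : h (fromℕ n) ≡ 𝟙 (suc m ≡ᵇ M) * v
    h-top = cong₂ (λ c p → 𝟙 ((c + 2 * p) ≡ᵇ M) * 2 ^ (2 * p))
      (sym (cyc≡cycCount (insertᵥ π (fromℕ n))) ∙ cyc-top) peaks-top
    h-after : ∀ a₀ → h (inject₁ a₀) ≡ G (createsPeak π-inj a₀)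
    h-after a₀ = cong₂ (λ c p → 𝟙 ((c + 2 * p) ≡ᵇ M) * 2 ^ (2 * p))
      (sym (cyc≡cycCount (insertᵥ π (inject₁ a₀))) ∙ cyc-after a₀) (peaks-after a₀)
    G-true : G true ≡ 𝟙 (suc (suc m) ≡ᵇ M) * (4 * v)
    G-true = cong₂ (λ x y → 𝟙 (x ≡ᵇ M) * 2 ^ y)
        (solve 2 (λ c p → c :+ con 2 :* (p :+ con 1) := con 2 :+ (c :+ con 2 :* p)) refl c p)
        (solve 1 (λ p → con 2 :* (p :+ con 1) := con 2 :+ con 2 :* p) refl p)
      ∙ cong (𝟙 (suc (suc m) ≡ᵇ M) *_) (solve 1 (λ v → con 2 :* (con 2 :* v) := con 4 :* v) refl v)
    G-false : G false ≡ 𝟙 (m ≡ᵇ M) * v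
    G-false = cong (λ y → 𝟙 ((c + 2 * y) ≡ᵇ M) * 2 ^ (2 * y)) (+-identityʳ p)
    local : ∀ M′ → 𝟙 (m ≡ᵇ M′) * v ≡ crunTerm π M′
    local M′ = sym (crun-weight-local π π-inj M′)

excWeight : ℕ → ℕ → ℕ
excWeight n e = sum (map (λ π → 𝟙 (exc π ≡ᵇ e) * 2 ^ (n ∸ cyc π)) (S n))

crunWeight : ℕ → ℕ → ℕ
crunWeight n m = sum (map (λ π → crunTerm π m) (S n))

excWeight-zero : ∀ e → excWeight 0 e ≡ 𝟙 (e ≡ᵇ 0)
excWeight-zero zero = refl
excWeight-zero (suc e) = refl

crunWeight-zero : ∀ m → crunWeight 0 m ≡ 𝟙 (m ≡ᵇ 0)
crunWeight-zero zero = refl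
crunWeight-zero (suc m) = refl

sum-previous : ∀ {A : Set} (xs : List A) (g : A → ℕ → ℕ) k →
  sum (map (λ x → previous (g x) k) xs) ≡ previous (λ j → sum (map (λ x → g x j) xs)) k
sum-previous xs g zero = sum-map-zero xs
sum-previous xs g (suc k) = refl

excWeight-suc : ∀ n e → excWeight (suc n) e ≡ suc (2 * e) * excWeight n e + previous (λ e′ → 2 * (n ∸ e′) * excWeight n e′) e
excWeight-suc n e = sum-S-suc n (λ σ → 𝟙 (exc σ ≡ᵇ e) * 2 ^ (suc n ∸ cyc σ))
  ∙ sum-map-cong (S n) (λ π π∈S → Insertion.exc-weights π (∈-S⁻ π π∈S) e)
  ∙ sum-map-+ (S n) (λ π → suc (2 * e) * term π e) (λ π → previous (λ e′ → 2 * (n ∸ e′) * term π e′) e)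
  ∙ cong₂ _+_ (sum-map-*ˡ (S n) (suc (2 * e)) (λ π → term π e))
              (sum-previous (S n) (λ π e′ → 2 * (n ∸ e′) * term π e′) e
               ∙ previous-cong (λ e′ → sum-map-*ˡ (S n) (2 * (n ∸ e′)) (λ π → term π e′)) e)
  where
  term : Perm n → ℕ → ℕ
  term π e = 𝟙 (exc π ≡ᵇ e) * 2 ^ (n ∸ cyc π)

crunWeight-suc : ∀ n m → crunWeight (suc n) m
  ≡ previous (crunWeight n) m + m * crunWeight n m + previous (previous (λ m′ → 4 * (n ∸ m′) * crunWeight n m′)) m
crunWeight-suc n m = sum-S-suc n (λ σ → crunTerm σ m)
  ∙ sum-map-cong (S n) (λ π π∈S → Insertion.crun-weights π (∈-S⁻ π π∈S) m)
  ∙ sum-map-+ (S n) (λ π → previous (crunTerm π) m + m * crunTerm π m) (λ π → previous (previous (g π)) m)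
  ∙ cong₂ _+_ (sum-map-+ (S n) (λ π → previous (crunTerm π) m) (λ π → m * crunTerm π m)
                ∙ cong₂ _+_ (sum-previous (S n) crunTerm m) (sum-map-*ˡ (S n) m (λ π → crunTerm π m)))
              (sum-previous (S n) (λ π → previous (g π)) m
               ∙ previous-cong (λ k → sum-previous (S n) g k ∙ previous-cong (λ m′ → sum-map-*ˡ (S n) (4 * (n ∸ m′)) (λ π → crunTerm π m′)) k) m)
  where
  g : Perm n → ℕ → ℕ
  g π m′ = 4 * (n ∸ m′) * crunTerm π m′

open Expansion excWeight crunWeight excWeight-zero excWeight-suc crunWeight-zero crunWeight-suc

sumBelow-parity : ∀ K (g : ℕ → ℕ) →
  sumBelow (suc (2 * K)) g ≡ g 0 + sumBelow K (λ i → g (2 * i + 1)) + sumBelow K (λ j → g (2 * j + 2))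
sumBelow-parity zero g = sym (+-identityʳ (g 0 + 0))
sumBelow-parity (suc K) g = begin
  sumBelow (suc (2 * suc K)) g
    ≡⟨ cong (λ d → sumBelow (suc d) g) (*-suc 2 K) ⟩
  sumBelow (suc (suc (suc (2 * K)))) g
    ≡⟨ sumBelow-last (suc (suc (2 * K))) g ∙ cong (_+ g (suc (suc (2 * K)))) (sumBelow-last (suc (2 * K)) g) ⟩
  sumBelow (suc (2 * K)) g + g (suc (2 * K)) + g (suc (suc (2 * K)))
    ≡⟨ cong (λ z → z + g (suc (2 * K)) + g (suc (suc (2 * K)))) (sumBelow-parity K g) ⟩
  g 0 + O + E + g (suc (2 * K)) + g (suc (suc (2 * K)))
    ≡⟨ solve 5 (λ a b c d e → a :+ b :+ c :+ d :+ e := a :+ (b :+ d) :+ (c :+ e)) refl (g 0) O E (g (suc (2 * K))) (g (suc (suc (2 * K)))) ⟩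
  g 0 + (O + g (suc (2 * K))) + (E + g (suc (suc (2 * K))))
    ≡⟨ cong₂ (λ a b → g 0 + (O + g a) + (E + g b)) (+-comm 1 (2 * K)) (+-comm 2 (2 * K)) ⟩
  g 0 + (O + g (2 * K + 1)) + (E + g (2 * K + 2))
    ≡⟨ sym (cong₂ (λ a b → g 0 + a + b) (sumBelow-last K (λ i → g (2 * i + 1))) (sumBelow-last K (λ j → g (2 * j + 2)))) ⟩
  g 0 + sumBelow (suc K) (λ i → g (2 * i + 1)) + sumBelow (suc K) (λ j → g (2 * j + 2)) ∎
  where
  O = sumBelow K (λ i → g (2 * i + 1))
  E = sumBelow K (λ j → g (2 * j + 2))

past-half : ∀ r n i → (n ∸ r) / 2 < i → n < r + 2 * i
past-half r n i half<i = ≤-<-trans (m≤n+m∸n n r) (+-monoʳ-< r (<-≤-trans (below-next-even (n ∸ r)) (*-monoʳ-≤ 2 half<i)))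
  where
  below-next-even : ∀ m → m < 2 * suc (m / 2)
  below-next-even m = subst (_< 2 * suc (m / 2)) (sym (m≡m%n+[m/n]*n m 2))
    (<-≤-trans (+-monoˡ-< ((m / 2) * 2) (m%n<n m 2)) (≤-reflexive (solve 1 (λ h → con 2 :+ h :* con 2 := con 2 :* (con 1 :+ h)) refl (m / 2))))

half-below : ∀ n r → (suc n ∸ suc r) / 2 < suc n
half-below n r = s≤s (≤-trans (m/n≤m (n ∸ r) 2) (m∸n≤m n r))

ξ⁺≡crunWeight : ∀ n i → ξ⁺ n i ≡ crunWeight n (2 * i + 1)
ξ⁺≡crunWeight n i = sum-filter (λ π → crun π ≟ 2 * i + 1) (S n) (λ π → 2 ^ (crun π ∸ cyc π))

ξ⁻≡crunWeight : ∀ n j → ξ⁻ n j ≡ crunWeight n (2 * j + 2)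
ξ⁻≡crunWeight n j = sum-filter (λ π → crun π ≟ 2 * j + 2) (S n) (λ π → 2 ^ (crun π ∸ cyc π))

sum-crunWeight≡rhs : ∀ n′ x → let n = suc n′ in sumBelow (suc n) (λ m → crunWeight n m * (x ^ ⌊ m /2⌋ * (1 + x) ^ (n ∸ m))) ≡ rhs n x
sum-crunWeight≡rhs n′ x = begin
  sumBelow (suc n) g
    ≡⟨ sumBelow-extend (suc n) (suc (2 * n)) g (s≤s (m≤n*m n 2)) (λ m n<m _ → vanishes m n<m) ⟩
  sumBelow (suc (2 * n)) g
    ≡⟨ sumBelow-parity n g ⟩
  g 0 + sumBelow n (λ i → g (2 * i + 1)) + sumBelow n (λ j → g (2 * j + 2))
    ≡⟨ cong₂ (λ a b → g 0 + a + b)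
         (sym (sumBelow-extend A n (λ i → g (2 * i + 1)) (half-below n′ 0) (λ i A≤i _ → vanishes _ (subst (n <_) (+-comm 1 (2 * i)) (past-half 1 n i A≤i)))))
         (sym (sumBelow-extend B n (λ j → g (2 * j + 2)) (half-below n′ 1) (λ j B≤j _ → vanishes _ (subst (n <_) (+-comm 2 (2 * j)) (past-half 2 n j B≤j))))) ⟩
  g 0 + sumBelow A (λ i → g (2 * i + 1)) + sumBelow B (λ j → g (2 * j + 2))
    ≡⟨ cong (λ z → z + sumBelow A (λ i → g (2 * i + 1)) + sumBelow B (λ j → g (2 * j + 2))) (cong (_* (1 * (1 + x) ^ n)) (crunWeight-suc n′ 0)) ⟩
  sumBelow A (λ i → g (2 * i + 1)) + sumBelow B (λ j → g (2 * j + 2))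
    ≡⟨ cong₂ _+_ (sym odd-terms) (sym even-terms) ⟩
  rhs n x ∎
  where
  n = suc n′
  g : ℕ → ℕ
  g m = crunWeight n m * (x ^ ⌊ m /2⌋ * (1 + x) ^ (n ∸ m))
  A = suc ((n ∸ 1) / 2)
  B = suc ((n ∸ 2) / 2)
  vanishes : ∀ m → n < m → g m ≡ 0
  vanishes m n<m = cong (_* (x ^ ⌊ m /2⌋ * (1 + x) ^ (n ∸ m))) (t-vanishes n m n<m)
  odd-terms : sum (map (λ i → ξ⁺ n i * x ^ i * (1 + x) ^ (n ∸ 1 ∸ 2 * i)) (upTo A)) ≡ sumBelow A (λ i → g (2 * i + 1))
  odd-terms = sum-applyUpTo (λ k → k) (λ i → ξ⁺ n i * x ^ i * (1 + x) ^ (n ∸ 1 ∸ 2 * i)) A ∙ sumBelow-cong A λ i _ →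
    cong (λ z → z * x ^ i * (1 + x) ^ (n ∸ 1 ∸ 2 * i)) (ξ⁺≡crunWeight n i) ∙ *-assoc (crunWeight n (2 * i + 1)) (x ^ i) _
    ∙ cong₂ (λ a b → crunWeight n (2 * i + 1) * (x ^ a * (1 + x) ^ b))
        (sym (cong ⌊_/2⌋ (solve 1 (λ i → con 2 :* i :+ con 1 := con 1 :+ (i :+ i)) refl i) ∙ ⌊r+2q/2⌋≡q 1 i ≤-refl))
        (∸-+-assoc n 1 (2 * i) ∙ cong (n ∸_) (+-comm 1 (2 * i)))
  even-terms : x * sum (map (λ j → ξ⁻ n j * x ^ j * (1 + x) ^ (n ∸ 2 ∸ 2 * j)) (upTo B)) ≡ sumBelow B (λ j → g (2 * j + 2))
  even-terms = cong (x *_) (sum-applyUpTo (λ k → k) (λ j → ξ⁻ n j * x ^ j * (1 + x) ^ (n ∸ 2 ∸ 2 * j)) B)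
    ∙ sym (sumBelow-*ˡ B x (λ j → ξ⁻ n j * x ^ j * (1 + x) ^ (n ∸ 2 ∸ 2 * j))) ∙ sumBelow-cong B λ j _ →
    cong (λ z → x * (z * x ^ j * (1 + x) ^ (n ∸ 2 ∸ 2 * j))) (ξ⁻≡crunWeight n j)
    ∙ solve 4 (λ x t p q → x :* (t :* p :* q) := t :* (x :* p :* q)) refl x (crunWeight n (2 * j + 2)) (x ^ j) ((1 + x) ^ (n ∸ 2 ∸ 2 * j))
    ∙ cong₂ (λ a b → crunWeight n (2 * j + 2) * (x ^ a * (1 + x) ^ b))
        (sym (cong ⌊_/2⌋ (solve 1 (λ j → con 2 :* j :+ con 2 := (con 1 :+ j) :+ (con 1 :+ j)) refl j) ∙ ⌊r+2q/2⌋≡q 0 (suc j) z≤n))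
        (∸-+-assoc n 2 (2 * j) ∙ cong (n ∸_) (+-comm 2 (2 * j)))

lhs≡sum-excWeight : ∀ n x → lhs n x ≡ sumBelow (suc n) (λ e → excWeight n e * x ^ e)
lhs≡sum-excWeight n x = begin
  sum (map (λ π → x ^ exc π * 2 ^ (n ∸ cyc π)) (S n))
    ≡⟨ sum-map-cong (S n) (λ π _ → sym (sumBelow-indicator (suc n) (exc π) (λ e → x ^ e * 2 ^ (n ∸ cyc π)) (s≤s (exc≤n π)))) ⟩
  sum (map (λ π → sumBelow (suc n) (λ e → 𝟙 (exc π ≡ᵇ e) * (x ^ e * 2 ^ (n ∸ cyc π)))) (S n))
    ≡⟨ sum-map-sumBelow (S n) (suc n) (λ π e → 𝟙 (exc π ≡ᵇ e) * (x ^ e * 2 ^ (n ∸ cyc π))) ⟩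
  sumBelow (suc n) (λ e → sum (map (λ π → 𝟙 (exc π ≡ᵇ e) * (x ^ e * 2 ^ (n ∸ cyc π))) (S n)))
    ≡⟨ sumBelow-cong (suc n) (λ e _ →
         sum-map-cong (S n) (λ π _ → solve 3 (λ i p w → i :* (p :* w) := p :* (i :* w)) refl (𝟙 (exc π ≡ᵇ e)) (x ^ e) (2 ^ (n ∸ cyc π)))
         ∙ sum-map-*ˡ (S n) (x ^ e) (λ π → 𝟙 (exc π ≡ᵇ e) * 2 ^ (n ∸ cyc π)) ∙ *-comm (x ^ e) _) ⟩
  sumBelow (suc n) (λ e → excWeight n e * x ^ e) ∎
  where
  exc≤n : ∀ π → exc π ≤ n
  exc≤n π = subst (_≤ n) (sym (exc≡excCount π)) (∑-𝟙≤ (excᵇ (lookup π)))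

2^[crun∸cyc]≡4^cpk : ∀ {n} (π : Perm n) → Injective _≡_ _≡_ (lookup π) → 2 ^ (crun π ∸ cyc π) ≡ 4 ^ cpk π
2^[crun∸cyc]≡4^cpk π π-inj = cong₂ (λ r c → 2 ^ (r ∸ c)) (crun≡cycCount+2*peakCount π π-inj) (cyc≡cycCount π)
  ∙ cong (2 ^_) (m+n∸m≡n (cycCount (lookup π)) _) ∙ sym (^-*-assoc 2 2 (peakCount (lookup π)))
  ∙ cong (4 ^_) (sym (cpk≡peakCount π π-inj))

sum-2^[crun∸cyc]≡sum-4^cpk : ∀ n m → sum (map (λ π → 2 ^ (crun π ∸ cyc π)) (Snm n m)) ≡ sum (map (λ π → 4 ^ cpk π) (Snm n m))
sum-2^[crun∸cyc]≡sum-4^cpk n m = sum-map-cong (Snm n m) λ π π∈Snm →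
  2^[crun∸cyc]≡4^cpk π (∈-S⁻ π (proj₁ (∈-filter⁻ (λ π → crun π ≟ m) {xs = S n} π∈Snm)))

theorem22 : (n : ℕ) → 2 ≤ n →
    ((x : ℕ) → lhs n x ≡ rhs n x)
    × ((i : ℕ) → i ≤ (n ∸ 1) / 2 → ξ⁺ n i ≡ ξ⁺' n i)
    × ((j : ℕ) → j ≤ (n ∸ 2) / 2 → ξ⁻ n j ≡ ξ⁻' n j)
theorem22 n@(suc n′) (s≤s _) =
  (λ x → lhs≡sum-excWeight n x ∙ polynomial-expansion n x ∙ sum-crunWeight≡rhs n′ x) ,
  (λ i _ → sum-2^[crun∸cyc]≡sum-4^cpk n (2 * i + 1)) ,
  (λ j _ → sum-2^[crun∸cyc]≡sum-4^cpk n (2 * j + 2))
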